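{- Let $D\ge2$, $N\in\{2D,2D+1\}$, and let $\Gamma$, $E_k$, $q^h_{ij}$ and $\Lambda$ be as in the context. Then the number of triples $(h,i,j)\in\{0,1,\dots,D\}^3$ with $q^h_{ij}\neq0$ equals $\dim(\Lambda)$.
   Context: $\Gamma$ is the cycle graph on $X=\{0,\dots,N-1\}=\mathbb{Z}/N\mathbb{Z}$, with $x\sim y$ iff $x-y\equiv\pm1 \pmod N$. Its distance is $\partial(x,y)=\min\{r,N-r\}$ with $r\equiv x-y \pmod N$, $0\le r<N$, and its diameter is $D$. Fix a primitive $N$-th root of unity $\zeta$ and set $\theta_i=\theta^*_i=\zeta^i+\zeta^{ -i}$ for $0\le i\le D$. $V$ has orthonormal basis $X$ and $A_1x=(x-1)+(x+1)$. $E_k$ is the orthogonal projection onto the $\theta_k$-eigenspace of $A_1$. The scalars $q^h_{ij}$ are defined by $E_i\circ E_j=N^{ -1}\sum_{h=0}^Dq^h_{ij}E_h$, where $\circ$ is the entrywise product of matrices with respect to the basis $X$. $\Lambda$ (the fundamental module) is the smallest subspace of $V^{\otimes3}$ that contains $\mathbf 1^{\otimes3}=\sum_{x,y,z}x\otimes y\otimes z$ and is invariant under: - $A^{(1)}=A_1\otimes I\otimes I$, $A^{(2)}=I\otimes A_1\otimes I$, $A^{(3)}=I\otimes I\otimes A_1$; - the diagonal maps $A^{*(1)},A^{*(2)},A^{*(3)}$ multiplying $x\otimes y\otimes z$ by $\theta^*_{\partial(y,z)}$, $\theta^*_{\partial(x,z)}$ and $\theta^*_{\partial(x,y)}$ respectively.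 -}

module Defs where

open import Level using (_⊔_)
open import Algebra.Bundles using (CommutativeRing)
open import Data.Nat as ℕ using (ℕ; zero; suc; _∸_; _⊓_; _%_)
open import Data.Fin as Fin using (Fin; toℕ)
open import Data.Product using (Σ; ∃; _×_; _,_)
open import Data.Bool using (if_then_else_)
open import Relation.Nullary using (¬_)
open import Relation.Nullary.Decidable using (⌊_⌋)
open import Relation.Binary.PropositionalEquality using (_≡_)
open import Function.Bundles using (_⇔_)

module _ {c ℓ} (R : CommutativeRing c ℓ) where
  open CommutativeRing R

  pow : Carrier → ℕ → Carrier
  pow x zero    = 1#
  pow x (suc n) = x * pow x n

  natR : ℕ → Carrier
  natR zero    = 0#
  natR (suc n) = 1# + natR n

  IsField : Set (c ⊔ ℓ)
  IsField = ¬ (1# ≈ 0#) × (∀ x → ¬ (x ≈ 0#) → ∃ λ y → x * y ≈ 1#)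

  CharZero : Set ℓ
  CharZero = ∀ n → natR n ≈ 0# → n ≡ 0

  IsPrimitiveRoot : ℕ → Carrier → Set ℓ
  IsPrimitiveRoot N ζ =
    pow ζ N ≈ 1# × (∀ k → 0 ℕ.< k → k ℕ.< N → ¬ (pow ζ k ≈ 1#))

  sumF : ∀ {n} → (Fin n → Carrier) → Carrier
  sumF {zero}  f = 0#
  sumF {suc n} f = f Fin.zero + sumF (λ i → f (Fin.suc i))

-- distance ∂(x,y) = min{r, N-r}, r ≡ x - y (mod N), 0 ≤ r < N
residue : ∀ {N} → Fin N → Fin N → ℕ
residue {suc n} x y = (toℕ x ℕ.+ (suc n ∸ toℕ y)) % suc n

dist : ∀ {N} → Fin N → Fin N → ℕ
dist {N} x y = residue x y ⊓ (N ∸ residue x y)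

module Cycle {c ℓ} (R : CommutativeRing c ℓ) (N D : ℕ) (ζ : CommutativeRing.Carrier R) where
  open CommutativeRing R

  -- θ_i = θ*_i = ζ^i + ζ^{-i}, with ζ^{-i} = ζ^{N-i} (as ζ^N = 1)
  θ : ℕ → Carrier
  θ i = pow R ζ i + pow R ζ (N ∸ i)

  Idx : Set
  Idx = Fin (suc D)

  Vect : Set c
  Vect = Fin N → Carrier

  Mat : Set c
  Mat = Fin N → Fin N → Carrier

  _≈V_ : Vect → Vect → Set ℓ
  u ≈V v = ∀ x → u x ≈ v x

  _≈M_ : Mat → Mat → Set ℓ
  M ≈M M' = ∀ x y → M x y ≈ M' x y

  _·V_ : Mat → Vect → Vect
  (M ·V v) x = sumF R (λ y → M x y * v y)

  _·M_ : Mat → Mat → Mat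
  (M ·M M') x z = sumF R (λ y → M x y * M' y z)

  A₁ : Mat
  A₁ x y = if ⌊ dist x y ℕ.≟ 1 ⌋ then 1# else 0#

  -- E is the orthogonal projection (w.r.t. the form in which X is
  -- orthonormal) onto the θ_k-eigenspace of A_1:
  -- idempotent, symmetric, and its range (= fixed space) is the eigenspace.
  IsEigenProj : Idx → Mat → Set (c ⊔ ℓ)
  IsEigenProj k E =
      ((E ·M E) ≈M E)
    × (∀ x y → E x y ≈ E y x)
    × (∀ v → ((E ·V v) ≈V v) ⇔ ((A₁ ·V v) ≈V (λ x → θ (toℕ k) * v x)))

  -- Krein parameters: E_i ∘ E_j = N⁻¹ Σ_h q^h_ij E_h,
  -- written as N (E_i ∘ E_j) = Σ_h q^h_ij E_h.  (q h i j = q^h_ij)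
  KreinEq : (Idx → Mat) → (Idx → Idx → Idx → Carrier) → Set ℓ
  KreinEq E q = ∀ i j x y →
    natR R N * (E i x y * E j x y) ≈ sumF R (λ h → q h i j * E h x y)

  -- number of triples (h,i,j) with q^h_ij ≠ 0 equals d:
  -- an injective enumeration by Fin d of exactly these triples
  Triple : Set
  Triple = Idx × Idx × Idx

  NonzeroCount : (Idx → Idx → Idx → Carrier) → ℕ → Set ℓ
  NonzeroCount q d = Σ (Fin d → Triple) λ f →
      (∀ k → let (h , i , j) = f k in ¬ (q h i j ≈ 0#))
    × (∀ k l → f k ≡ f l → k ≡ l)
    × (∀ h i j → ¬ (q h i j ≈ 0#) → ∃ λ k → f k ≡ (h , i , j))

  Tensor : Set c
  Tensor = Fin N → Fin N → Fin N → Carrier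

  _≈T_ : Tensor → Tensor → Set ℓ
  u ≈T v = ∀ x y z → u x y z ≈ v x y z

  𝟙³ : Tensor
  𝟙³ _ _ _ = 1#

  A⁽¹⁾ A⁽²⁾ A⁽³⁾ : Tensor → Tensor
  A⁽¹⁾ t x y z = sumF R (λ x' → A₁ x x' * t x' y z)
  A⁽²⁾ t x y z = sumF R (λ y' → A₁ y y' * t x y' z)
  A⁽³⁾ t x y z = sumF R (λ z' → A₁ z z' * t x y z')

  A*⁽¹⁾ A*⁽²⁾ A*⁽³⁾ : Tensor → Tensor
  A*⁽¹⁾ t x y z = θ (dist y z) * t x y z
  A*⁽²⁾ t x y z = θ (dist x z) * t x y z
  A*⁽³⁾ t x y z = θ (dist x y) * t x y z

  -- Λ: the smallest subspace of V^{⊗3} containing 𝟙³ and invariant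
  -- under the six maps (inductive closure)
  data InΛ : Tensor → Set (c ⊔ ℓ) where
    one   : InΛ 𝟙³
    zer   : InΛ (λ _ _ _ → 0#)
    add   : ∀ {u v} → InΛ u → InΛ v → InΛ (λ x y z → u x y z + v x y z)
    scale : ∀ a {u} → InΛ u → InΛ (λ x y z → a * u x y z)
    resp  : ∀ {u v} → u ≈T v → InΛ u → InΛ v
    a1    : ∀ {u} → InΛ u → InΛ (A⁽¹⁾ u)
    a2    : ∀ {u} → InΛ u → InΛ (A⁽²⁾ u)
    a3    : ∀ {u} → InΛ u → InΛ (A⁽³⁾ u)
    a*1   : ∀ {u} → InΛ u → InΛ (A*⁽¹⁾ u)
    a*2   : ∀ {u} → InΛ u → InΛ (A*⁽²⁾ u)
    a*3   : ∀ {u} → InΛ u → InΛ (A*⁽³⁾ u)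

  lincomb : ∀ {d} → (Fin d → Carrier) → (Fin d → Tensor) → Tensor
  lincomb c b x y z = sumF R (λ k → c k * b k x y z)

  DimΛ : ℕ → Set (c ⊔ ℓ)
  DimΛ d = Σ (Fin d → Tensor) λ b →
      (∀ k → InΛ (b k))
    × (∀ a → lincomb a b ≈T (λ _ _ _ → 0#) → ∀ k → a k ≈ 0#)
    × (∀ v → InΛ v → ∃ λ a → v ≈T lincomb a b)

{-# OPTIONS --safe #-}
module Submission where

-- The dihedral maps w ↦ ±w + c are isometries of the cycle, and they act transitively on
-- triangles with given side lengths: two vectors of ℤ/N known up to sign whose difference is
-- known up to sign are known up to a common sign. The generators of Λ commute with these
-- isometries, so every element of Λ is a function of the distance profile
-- (∂(y,z), ∂(x,z), ∂(x,y)). Conversely, θ_0, ..., θ_D are distinct because ζ is primitive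
-- and D ≤ N/2, so Lagrange interpolation in A^{*(1)}, A^{*(2)}, A^{*(3)} puts the indicator
-- of each realised profile into Λ; hence dim Λ is the number of realised profiles.
--
-- The characters ψ_m(x) = ζ^{mx} are eigenvectors of A_1 with eigenvalue ζ^m + ζ^{-m}, so
-- N E_k(x,0) = Σ_{m ≡ ±k} ψ_m(x). Comparing Fourier coefficients in the Krein equation gives
-- q^h_ij = #{(a,b) : a ≡ ±i, b ≡ ±j, a + b ≡ h (mod N)}, and such a pair (a, b) is exactly a
-- triangle (a, a + b, 0) with profile (h, i, j). So q^h_ij ≠ 0 iff (h, i, j) is realised.

open import Level using (_⊔_)
open import Algebra.Bundles using (CommutativeRing)
import Algebra.Properties.CommutativeSemigroup as CommutativeSemigroupProperties
import Algebra.Properties.Ring as RingProperties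
import Algebra.Properties.Semiring.Sum as SemiringSum
import Algebra.Properties.Semiring.Mult as SemiringMult
import Algebra.Properties.Semiring.Exp as SemiringExp
import Algebra.Properties.Monoid.Sum as MonoidSum
open import Data.Bool using (if_then_else_)
open import Data.Empty using (⊥-elim)
open import Data.Fin as Fin using (Fin; toℕ; fromℕ<; punchIn)
import Data.Fin.Properties as Finₚ
open import Data.Fin.Permutation using (Permutation′; permutation; _⟨$⟩ʳ_)
open import Data.Integer as ℤ using (ℤ; +_; ∣_∣; 0ℤ; 1ℤ; -1ℤ)
import Data.Integer.Properties as ℤₚ
open import Data.Integer.DivMod using (_%ℕ_; _/ℕ_; n%ℕd<d; a≡a%ℕn+[a/ℕn]*n)
open import Data.Integer.Divisibility.Signed using (_∣_; divides; ∣m∣n⇒∣m+n; ∣m⇒∣-m; ∣n⇒∣m*n; ∣⇒∣ᵤ)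
open import Data.Integer.Tactic.RingSolver using (solve-∀)
open import Data.Nat as ℕ using (ℕ; zero; suc; _∸_; _⊓_; _%_; NonZero; z≤n; s≤s)
import Data.Nat.Properties as ℕₚ
open import Data.Nat.DivMod using (m≡m%n+[m/n]*n; m%n<n; m*n%n≡0)
import Data.Nat.Divisibility as ℕ∣
open import Data.Product using (Σ; ∃; ∃₂; _×_; _,_; proj₁; proj₂)
open import Data.Product.Function.NonDependent.Propositional using (_×-↔_)
open import Data.Sign using (Sign)
open import Data.Sum using (_⊎_; inj₁; inj₂; [_,_]′)
open import Function using (_∘_; _↔_; _⇔_; Inverse; Equivalence)
open import Function.Properties.Inverse using (↔-refl; ↔-sym; ↔-trans)
open import Relation.Nullary using (¬_; ¬?; Dec; yes; no)
open import Relation.Nullary.Decidable using (_×-dec_; ⌊_⌋)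
open import Relation.Unary using (Pred; Decidable)
open import Relation.Binary.Bundles using (Setoid)
open import Relation.Binary.Structures using (IsEquivalence)
open import Relation.Binary.Definitions using (Reflexive; Symmetric; Transitive)
import Relation.Binary.Reasoning.Setoid as SetoidReasoning
open import Relation.Binary.PropositionalEquality as ≡ using (_≡_; _≢_)

open import Defs

module IntegerIdentities where
  open import Data.Integer.Base using (_+_; _-_; -_; _*_)

  [a-b]+b≡a : ∀ a b → (a - b) + b ≡ a
  [a-b]+b≡a = solve-∀

  a-[a-b]≡b : ∀ a b → a - (a - b) ≡ b
  a-[a-b]≡b = solve-∀

  -[a-b]≡b-a : ∀ a b → - (a - b) ≡ b - a
  -[a-b]≡b-a = solve-∀

  [a-c]-[b-c]≡a-b : ∀ a b c → (a - c) - (b - c) ≡ a - b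
  [a-c]-[b-c]≡a-b = solve-∀

  [a+c]-[b+d]≡[a-b]+[c-d] : ∀ a b c d → (a + c) - (b + d) ≡ (a - b) + (c - d)
  [a+c]-[b+d]≡[a-b]+[c-d] = solve-∀

  -a-[-b]≡-[a-b] : ∀ a b → - a - - b ≡ - (a - b)
  -a-[-b]≡-[a-b] = solve-∀

  ca-cb≡c[a-b] : ∀ a b c → c * a - c * b ≡ c * (a - b)
  ca-cb≡c[a-b] = solve-∀

  -[a-b]+-b≡-a : ∀ a b → - (a - b) + - b ≡ - a
  -[a-b]+-b≡-a = solve-∀

  -a--[a-b]≡-b : ∀ a b → - a - - (a - b) ≡ - b
  -a--[a-b]≡-b = solve-∀

  [a+kn]-a≡kn : ∀ a k n → (a + k * n) - a ≡ k * n
  [a+kn]-a≡kn = solve-∀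

  [a+b]-b≡a : ∀ a b → (a + b) - b ≡ a
  [a+b]-b≡a = solve-∀

  a-[a+b]≡-b : ∀ a b → a - (a + b) ≡ - b
  a-[a+b]≡-b = solve-∀

  [a-c]+[b-a]≡b-c : ∀ a b c → (a - c) + (b - a) ≡ b - c
  [a-c]+[b-a]≡b-c = solve-∀

  [c-a]+[a-b]≡-[b-c] : ∀ a b c → (c - a) + (a - b) ≡ - (b - c)
  [c-a]+[a-b]≡-[b-c] = solve-∀

residue-def : ∀ {N} .{{_ : NonZero N}} (x y : Fin N) →
              residue x y ≡ (toℕ x ℕ.+ (N ∸ toℕ y)) % N
residue-def {suc n} x y = ≡.refl

-- Integers modulo N and the distance of the cycle

module Modular (N : ℕ) .{{_ : NonZero N}} where
  open import Data.Integer.Base using (_+_; _-_; -_; _*_)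
  open IntegerIdentities

  infix 4 _≋_ _≋±_

  -- A record rather than a synonym, so that a and b can be inferred.
  record _≋_ (a b : ℤ) : Set where
    constructor mk≋
    field N∣a-b : + N ∣ a - b

  private
    N∣-resp : ∀ {a b} → a ≡ b → + N ∣ a → + N ∣ b
    N∣-resp = ≡.subst (+ N ∣_)

  ≋-refl : Reflexive _≋_
  ≋-refl {a} = mk≋ (N∣-resp (≡.sym (ℤₚ.+-inverseʳ a)) (divides 0ℤ ≡.refl))

  ≋-reflexive : ∀ {a b} → a ≡ b → a ≋ b
  ≋-reflexive ≡.refl = ≋-refl

  ≋-sym : Symmetric _≋_
  ≋-sym {a} {b} (mk≋ p) = mk≋ (N∣-resp (-[a-b]≡b-a a b) (∣m⇒∣-m p))

  ≋-trans : Transitive _≋_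
  ≋-trans {a} {b} {c} (mk≋ p) (mk≋ q) =
    mk≋ (N∣-resp (ℤₚ.+-minus-telescope a b c) (∣m∣n⇒∣m+n p q))

  ≋-isEquivalence : IsEquivalence _≋_
  ≋-isEquivalence = record { refl = ≋-refl ; sym = ≋-sym ; trans = ≋-trans }

  ≋-setoid : Setoid _ _
  ≋-setoid = record { isEquivalence = ≋-isEquivalence }

  module ≋-Reasoning = SetoidReasoning ≋-setoid

  +-cong-≋ : ∀ {a b c d} → a ≋ b → c ≋ d → a + c ≋ b + d
  +-cong-≋ {a} {b} {c} {d} (mk≋ p) (mk≋ q) =
    mk≋ (N∣-resp (≡.sym ([a+c]-[b+d]≡[a-b]+[c-d] a b c d)) (∣m∣n⇒∣m+n p q))

  neg-cong-≋ : ∀ {a b} → a ≋ b → - a ≋ - b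
  neg-cong-≋ {a} {b} (mk≋ p) = mk≋ (N∣-resp (≡.sym (-a-[-b]≡-[a-b] a b)) (∣m⇒∣-m p))

  minus-cong-≋ : ∀ {a b c d} → a ≋ b → c ≋ d → a - c ≋ b - d
  minus-cong-≋ p q = +-cong-≋ p (neg-cong-≋ q)

  *-congˡ-≋ : ∀ c {a b} → a ≋ b → c * a ≋ c * b
  *-congˡ-≋ c {a} {b} (mk≋ p) = mk≋ (N∣-resp (≡.sym (ca-cb≡c[a-b] a b c)) (∣n⇒∣m*n c p))

  +-multiple-≋ : ∀ a k → a + k * + N ≋ a
  +-multiple-≋ a k = mk≋ (N∣-resp (≡.sym ([a+kn]-a≡kn a k (+ N))) (divides k ≡.refl))

  N≋0 : + N ≋ 0ℤ
  N≋0 = ≋-trans (≋-reflexive N≡0+1*N) (+-multiple-≋ 0ℤ 1ℤ)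
    where
    N≡0+1*N : + N ≡ 0ℤ + 1ℤ * + N
    N≡0+1*N = ≡.sym (≡.trans (ℤₚ.+-identityˡ _) (ℤₚ.*-identityˡ (+ N)))

  ≋-neg-neg : ∀ {a b} → a ≋ - b → - a ≋ b
  ≋-neg-neg {a} {b} p = ≋-trans (neg-cong-≋ p) (≋-reflexive (ℤₚ.neg-involutive b))

  ≋0⇒≋ : ∀ {a b} → a - b ≋ 0ℤ → a ≋ b
  ≋0⇒≋ {a} {b} p = begin
    a             ≡⟨ [a-b]+b≡a a b ⟨
    (a - b) + b   ≈⟨ +-cong-≋ p ≋-refl ⟩
    0ℤ + b        ≡⟨ ℤₚ.+-identityˡ b ⟩
    b             ∎
    where open ≋-Reasoning

  +≋0⇒≋- : ∀ {a b} → a + b ≋ 0ℤ → a ≋ - b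
  +≋0⇒≋- {a} {b} p = ≋0⇒≋ (≋-trans (≋-reflexive (≡.cong (λ t → a + t) (ℤₚ.neg-involutive b))) p)

  ≋⇒≋0 : ∀ {a b} → a ≋ b → a - b ≋ 0ℤ
  ≋⇒≋0 {a} {b} p = ≋-trans (+-cong-≋ p ≋-refl) (≋-reflexive (ℤₚ.+-inverseʳ b))

  canonical : ∀ {m k} → m ℕ.< N → k ℕ.< N → + m ≋ + k → m ≡ k
  canonical {m} {k} m<N k<N (mk≋ p) = ℤₚ.+-injective (≋0-small (≡.subst (ℕ._< N) ∣m-k∣ ∣m⊖k∣<N))
    where
    ∣m-k∣ : ∣ m ℤ.⊖ k ∣ ≡ ∣ + m - + k ∣
    ∣m-k∣ = ≡.cong ∣_∣ (≡.sym (ℤₚ.[+m]-[+n]≡m⊖n m k))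
    ∣m⊖k∣<N : ∣ m ℤ.⊖ k ∣ ℕ.< N
    ∣m⊖k∣<N = ℕₚ.≤-<-trans (ℤₚ.∣m⊝n∣≤m⊔n m k) (ℕₚ.⊔-lub m<N k<N)
    ≋0-small : ∣ + m - + k ∣ ℕ.< N → + m ≡ + k
    ≋0-small small with ∣ + m - + k ∣ in eq
    ... | zero  = ≡.trans (≡.sym ([a-b]+b≡a (+ m) (+ k)))
                        (≡.cong (_+ + k) (ℤₚ.∣i∣≡0⇒i≡0 {+ m - + k} eq))
    ... | suc _ = ⊥-elim (ℕₚ.<⇒≱ small (ℕ∣.∣⇒≤ (≡.subst (ℕ∣._∣_ N) eq (∣⇒∣ᵤ p))))

  %ℕ-≋ : ∀ a → + (a %ℕ N) ≋ a
  %ℕ-≋ a = ≋-sym (≋-trans (≋-reflexive (a≡a%ℕn+[a/ℕn]*n a N)) (+-multiple-≋ _ (a /ℕ N)))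

  %ℕ<N : ∀ a → a %ℕ N ℕ.< N
  %ℕ<N a = n%ℕd<d a N

  ≋⇒%ℕ≡ : ∀ {a b} → a ≋ b → a %ℕ N ≡ b %ℕ N
  ≋⇒%ℕ≡ {a} {b} p =
    canonical (%ℕ<N a) (%ℕ<N b) (≋-trans (%ℕ-≋ a) (≋-trans p (≋-sym (%ℕ-≋ b))))

  ≋-dec : ∀ a b → Dec (a ≋ b)
  ≋-dec a b with (a %ℕ N) ℕ.≟ (b %ℕ N)
  ... | yes eq = yes (≋-trans (≋-sym (%ℕ-≋ a)) (≋-trans (≋-reflexive (≡.cong +_ eq)) (%ℕ-≋ b)))
  ... | no neq = no (λ p → neq (≋⇒%ℕ≡ p))

  %-≋ : ∀ m → + (m % N) ≋ + m
  %-≋ m = ≋-sym (begin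
    + m                              ≡⟨ ≡.cong +_ (m≡m%n+[m/n]*n m N) ⟩
    + (m % N ℕ.+ m ℕ./ N ℕ.* N)      ≡⟨ ℤₚ.pos-+ (m % N) (m ℕ./ N ℕ.* N) ⟩
    + (m % N) + + (m ℕ./ N ℕ.* N)    ≡⟨ ≡.cong (λ t → + (m % N) + t) (ℤₚ.pos-* (m ℕ./ N) N) ⟩
    + (m % N) + + (m ℕ./ N) * + N    ≈⟨ +-multiple-≋ (+ (m % N)) (+ (m ℕ./ N)) ⟩
    + (m % N)                        ∎)
    where open ≋-Reasoning

  +-∸ : ∀ {m k} → k ℕ.≤ m → + (m ∸ k) ≡ + m - + k
  +-∸ {m} {k} k≤m = ≡.trans (≡.sym (ℤₚ.⊖-≥ k≤m)) (≡.sym (ℤₚ.m-n≡m⊖n m k))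

  N∸r≋-r : ∀ {r} → r ℕ.≤ N → + (N ∸ r) ≋ - + r
  N∸r≋-r {r} r≤N = begin
    + (N ∸ r)   ≡⟨ +-∸ r≤N ⟩
    + N - + r   ≈⟨ +-cong-≋ N≋0 (≋-refl { - + r}) ⟩
    0ℤ - + r    ≡⟨ ℤₚ.+-identityˡ (- + r) ⟩
    - + r       ∎
    where open ≋-Reasoning

  val : Fin N → ℤ
  val x = + toℕ x

  fromℤ : ℤ → Fin N
  fromℤ a = fromℕ< (%ℕ<N a)

  val-fromℤ : ∀ a → val (fromℤ a) ≋ a
  val-fromℤ a = ≋-trans (≋-reflexive (≡.cong +_ (Finₚ.toℕ-fromℕ< (%ℕ<N a)))) (%ℕ-≋ a)

  origin : Fin N
  origin = fromℤ 0ℤ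

  val-origin : ∀ a → a - val origin ≋ a
  val-origin a = begin
    a - val origin   ≈⟨ minus-cong-≋ (≋-refl {a}) (val-fromℤ 0ℤ) ⟩
    a - 0ℤ           ≡⟨ ℤₚ.+-identityʳ a ⟩
    a                ∎
    where open ≋-Reasoning

  val-injective : ∀ {x y} → val x ≋ val y → x ≡ y
  val-injective p = Finₚ.toℕ-injective (canonical (Finₚ.toℕ<n _) (Finₚ.toℕ<n _) p)

  fromℤ-≋ : ∀ {a x} → a ≋ val x → fromℤ a ≡ x
  fromℤ-≋ p = val-injective (≋-trans (val-fromℤ _) p)

  residue<N : ∀ x y → residue x y ℕ.< N
  residue<N x y = ≡.subst (ℕ._< N) (≡.sym (residue-def x y)) (m%n<n _ N)

  residue-≋ : ∀ x y → + residue x y ≋ val x - val y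
  residue-≋ x y = begin
    + residue x y                          ≡⟨ ≡.cong +_ (residue-def x y) ⟩
    + ((toℕ x ℕ.+ (N ∸ toℕ y)) % N)        ≈⟨ %-≋ (toℕ x ℕ.+ (N ∸ toℕ y)) ⟩
    + (toℕ x ℕ.+ (N ∸ toℕ y))              ≡⟨ ℤₚ.pos-+ (toℕ x) (N ∸ toℕ y) ⟩
    val x + + (N ∸ toℕ y)                  ≈⟨ +-cong-≋ (≋-refl {val x}) (N∸r≋-r (ℕₚ.<⇒≤ (Finₚ.toℕ<n y))) ⟩
    val x - val y                          ∎
    where open ≋-Reasoning

  _≋±_ : ℤ → ℤ → Set
  a ≋± b = a ≋ b ⊎ a ≋ - b

  ≋±-refl : ∀ {a} → a ≋± a
  ≋±-refl = inj₁ ≋-refl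

  ≋±-sym : ∀ {a b} → a ≋± b → b ≋± a
  ≋±-sym (inj₁ p) = inj₁ (≋-sym p)
  ≋±-sym (inj₂ p) = inj₂ (≋-sym (≋-neg-neg p))

  ≋±-trans : ∀ {a b c} → a ≋± b → b ≋± c → a ≋± c
  ≋±-trans (inj₁ p) (inj₁ q) = inj₁ (≋-trans p q)
  ≋±-trans (inj₁ p) (inj₂ q) = inj₂ (≋-trans p q)
  ≋±-trans (inj₂ p) (inj₁ q) = inj₂ (≋-trans p (neg-cong-≋ q))
  ≋±-trans (inj₂ p) (inj₂ q) = inj₁ (≋-trans p (≋-neg-neg q))

  ≋±-negˡ : ∀ {a b} → a ≋± b → - a ≋± b
  ≋±-negˡ (inj₁ p) = inj₂ (neg-cong-≋ p)
  ≋±-negˡ (inj₂ p) = inj₁ (≋-neg-neg p)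

  ≋±-dec : ∀ a b → Dec (a ≋± b)
  ≋±-dec a b with ≋-dec a b | ≋-dec a (- b)
  ... | yes p | _     = yes (inj₁ p)
  ... | no _  | yes q = yes (inj₂ q)
  ... | no ¬p | no ¬q = no [ ¬p , ¬q ]′

  -- dist x y unfolds to fold (residue x y).
  fold : ℕ → ℕ
  fold r = r ⊓ (N ∸ r)

  fold-≋± : ∀ {r} → r ℕ.≤ N → + r ≋± + fold r
  fold-≋± {r} r≤N with ℕₚ.⊓-sel r (N ∸ r)
  ... | inj₁ fold≡r   = inj₁ (≋-reflexive (≡.cong +_ (≡.sym fold≡r)))
  ... | inj₂ fold≡N∸r = inj₂ (≋-sym (≋-neg-neg (≋-trans (≋-reflexive (≡.cong +_ fold≡N∸r)) (N∸r≋-r r≤N))))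

  fold-N∸ : ∀ {s} → s ℕ.≤ N → fold (N ∸ s) ≡ fold s
  fold-N∸ {s} s≤N = ≡.trans (≡.cong ((N ∸ s) ⊓_) (ℕₚ.m∸[m∸n]≡n s≤N)) (ℕₚ.⊓-comm (N ∸ s) s)

  ≋±⇒fold≡ : ∀ {r s} → r ℕ.< N → s ℕ.< N → + r ≋± + s → fold r ≡ fold s
  ≋±⇒fold≡ r<N s<N (inj₁ p) = ≡.cong fold (canonical r<N s<N p)
  ≋±⇒fold≡ {s = zero} r<N s<N (inj₂ p) = ≡.cong fold (canonical r<N s<N p)
  ≋±⇒fold≡ {r} {s@(suc _)} r<N s<N (inj₂ p) =
    ≡.trans (≡.cong fold r≡N∸s) (fold-N∸ (ℕₚ.<⇒≤ s<N))
    where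
    r≡N∸s : r ≡ N ∸ s
    r≡N∸s = canonical r<N (ℕₚ.∸-monoʳ-< (s≤s z≤n) (ℕₚ.<⇒≤ s<N))
                      (≋-trans p (≋-sym (N∸r≋-r (ℕₚ.<⇒≤ s<N))))

  dist≋± : ∀ x y → val x - val y ≋± + dist x y
  dist≋± x y = ≋±-trans (inj₁ (≋-sym (residue-≋ x y))) (fold-≋± (ℕₚ.<⇒≤ (residue<N x y)))

  ≋±⇒dist≡ : ∀ x y x' y' → val x - val y ≋± val x' - val y' → dist x y ≡ dist x' y'
  ≋±⇒dist≡ x y x' y' p = ≋±⇒fold≡ (residue<N x y) (residue<N x' y')
    (≋±-trans (inj₁ (residue-≋ x y)) (≋±-trans p (inj₁ (≋-sym (residue-≋ x' y')))))

  dist≡⇒≋± : ∀ x y x' y' → dist x y ≡ dist x' y' → val x - val y ≋± val x' - val y'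
  dist≡⇒≋± x y x' y' eq =
    ≋±-trans (dist≋± x y) (≡.subst (λ d → + d ≋± val x' - val y') (≡.sym eq) (≋±-sym (dist≋± x' y')))

  dist-sym : ∀ x y → dist x y ≡ dist y x
  dist-sym x y = ≋±⇒dist≡ x y y x (inj₂ (≋-reflexive (≡.sym (-[a-b]≡b-a (val y) (val x)))))

  module Bounded (D : ℕ) (2D≤N : D ℕ.+ D ℕ.≤ N) (N≤2D+1 : N ℕ.≤ suc (D ℕ.+ D)) where

    ≤D⇒<N : ∀ {k} → k ℕ.≤ D → k ℕ.< N
    ≤D⇒<N k≤D = ℕₚ.≤-<-trans k≤D (half<N D 2D≤N)
      where
      half<N : ∀ d → d ℕ.+ d ℕ.≤ N → d ℕ.< N
      half<N zero    _      = ℕ.>-nonZero⁻¹ N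
      half<N (suc d) 2d≤N = ℕₚ.<-≤-trans (ℕₚ.m<m+n (suc d) (s≤s z≤n)) 2d≤N

    fold-≤D : ∀ {k} → k ℕ.≤ D → fold k ≡ k
    fold-≤D {k} k≤D = ℕₚ.m≤n⇒m⊓n≡m (begin
      k                ≡⟨ ℕₚ.m+n∸n≡m k k ⟨
      (k ℕ.+ k) ∸ k    ≤⟨ ℕₚ.∸-monoˡ-≤ k (ℕₚ.≤-trans (ℕₚ.+-mono-≤ k≤D k≤D) 2D≤N) ⟩
      N ∸ k            ∎)
      where open ℕₚ.≤-Reasoning

    fold≤D : ∀ r → fold r ℕ.≤ D
    fold≤D r with ℕₚ.≤-<-connex r D
    ... | inj₁ r≤D = ℕₚ.≤-trans (ℕₚ.m⊓n≤m r (N ∸ r)) r≤D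
    ... | inj₂ D<r = begin
      fold r                       ≤⟨ ℕₚ.m⊓n≤n r (N ∸ r) ⟩
      N ∸ r                        ≤⟨ ℕₚ.∸-monoʳ-≤ N D<r ⟩
      N ∸ suc D                    ≤⟨ ℕₚ.∸-monoˡ-≤ (suc D) N≤2D+1 ⟩
      (D ℕ.+ D) ∸ D                ≡⟨ ℕₚ.m+n∸n≡m D D ⟩
      D                            ∎
      where open ℕₚ.≤-Reasoning

    dist≤D : ∀ (x y : Fin N) → dist x y ℕ.≤ D
    dist≤D x y = fold≤D (residue x y)

    ≋±-injective : ∀ {k l} → k ℕ.≤ D → l ℕ.≤ D → + k ≋± + l → k ≡ l
    ≋±-injective k≤D l≤D p =
      ≡.trans (≡.sym (fold-≤D k≤D)) (≡.trans (≋±⇒fold≡ (≤D⇒<N k≤D) (≤D⇒<N l≤D) p) (fold-≤D l≤D))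

    ≋±⇒dist≡ᴰ : ∀ (x y : Fin N) {k} → k ℕ.≤ D → val x - val y ≋± + k → dist x y ≡ k
    ≋±⇒dist≡ᴰ x y k≤D p = ≡.trans
      (≋±⇒fold≡ (residue<N x y) (≤D⇒<N k≤D) (≋±-trans (inj₁ (residue-≋ x y)) p))
      (fold-≤D k≤D)

  -- Isometries of the cycle

  sign-unit : Sign → ℤ
  sign-unit Sign.+ = 1ℤ
  sign-unit Sign.- = -1ℤ

  sign-unit² : ∀ s → sign-unit s * sign-unit s ≡ 1ℤ
  sign-unit² Sign.+ = ≡.refl
  sign-unit² Sign.- = ≡.refl

  sign-unit-≋± : ∀ s a → sign-unit s * a ≋± a
  sign-unit-≋± Sign.+ a = inj₁ (≋-reflexive (ℤₚ.*-identityˡ a))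
  sign-unit-≋± Sign.- a = inj₂ (≋-reflexive (ℤₚ.-1*i≡-i a))

  private
    Signed : ℤ → ℤ → ℤ → ℤ → Set
    Signed u v u' v' = ∃ λ s → u' ≋ sign-unit s * u × v' ≋ sign-unit s * v

    same-sign : ∀ {u v u' v'} → u' ≋ u → v' ≋ v → Signed u v u' v'
    same-sign {u} {v} p q = Sign.+ ,
      ≋-trans p (≋-reflexive (≡.sym (ℤₚ.*-identityˡ u))) ,
      ≋-trans q (≋-reflexive (≡.sym (ℤₚ.*-identityˡ v)))

    opposite-sign : ∀ {u v u' v'} → u' ≋ - u → v' ≋ - v → Signed u v u' v'
    opposite-sign {u} {v} p q = Sign.- ,
      ≋-trans p (≋-reflexive (≡.sym (ℤₚ.-1*i≡-i u))) ,
      ≋-trans q (≋-reflexive (≡.sym (ℤₚ.-1*i≡-i v)))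

  ±-rigidity : ∀ {u v u' v'} → u' ≋± u → v' ≋± v → u' - v' ≋± u - v → Signed u v u' v'
  ±-rigidity (inj₁ p) (inj₁ q) _ = same-sign p q
  ±-rigidity (inj₂ p) (inj₂ q) _ = opposite-sign p q
  ±-rigidity {u} {v} {u'} {v'} (inj₁ p) (inj₂ _) (inj₁ r) = same-sign p (begin
    v'               ≡⟨ a-[a-b]≡b u' v' ⟨
    u' - (u' - v')   ≈⟨ minus-cong-≋ p r ⟩
    u - (u - v)      ≡⟨ a-[a-b]≡b u v ⟩
    v                ∎)
    where open ≋-Reasoning
  ±-rigidity {u} {v} {u'} {v'} (inj₁ _) (inj₂ q) (inj₂ r) = opposite-sign (begin
    u'                 ≡⟨ [a-b]+b≡a u' v' ⟨
    (u' - v') + v'     ≈⟨ +-cong-≋ r q ⟩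
    - (u - v) + - v    ≡⟨ -[a-b]+-b≡-a u v ⟩
    - u                ∎) q
    where open ≋-Reasoning
  ±-rigidity {u} {v} {u'} {v'} (inj₂ _) (inj₁ q) (inj₁ r) = same-sign (begin
    u'               ≡⟨ [a-b]+b≡a u' v' ⟨
    (u' - v') + v'   ≈⟨ +-cong-≋ r q ⟩
    (u - v) + v      ≡⟨ [a-b]+b≡a u v ⟩
    u                ∎) q
    where open ≋-Reasoning
  ±-rigidity {u} {v} {u'} {v'} (inj₂ p) (inj₁ _) (inj₂ r) = opposite-sign p (begin
    v'                 ≡⟨ a-[a-b]≡b u' v' ⟨
    u' - (u' - v')     ≈⟨ minus-cong-≋ p r ⟩
    - u - - (u - v)    ≡⟨ -a--[a-b]≡-b u v ⟩
    - v                ∎)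
    where open ≋-Reasoning

  record Isometry : Set where
    field
      π              : Permutation′ N
      preserves-dist : ∀ a b → dist (π ⟨$⟩ʳ a) (π ⟨$⟩ʳ b) ≡ dist a b

  affine : Sign → Fin N → Fin N → Fin N → Fin N
  affine s z z' w = fromℤ (sign-unit s * (val w - val z) + val z')

  affine-≋ : ∀ s z z' w → val (affine s z z' w) - val z' ≋ sign-unit s * (val w - val z)
  affine-≋ s z z' w = begin
    val (affine s z z' w) - val z'      ≈⟨ minus-cong-≋ (val-fromℤ (sw + val z')) (≋-refl {val z'}) ⟩
    (sw + val z') - val z'              ≡⟨ [a+b]-b≡a sw (val z') ⟩
    sw                                  ∎
    where
    open ≋-Reasoning
    sw : ℤ
    sw = sign-unit s * (val w - val z)

  affine-≡ : ∀ s z z' {w w'} → val w' - val z' ≋ sign-unit s * (val w - val z) → affine s z z' w ≡ w'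
  affine-≡ s z z' {w} {w'} p = fromℤ-≋ (begin
    sign-unit s * (val w - val z) + val z'   ≈⟨ +-cong-≋ (≋-sym p) (≋-refl {val z'}) ⟩
    (val w' - val z') + val z'               ≡⟨ [a-b]+b≡a (val w') (val z') ⟩
    val w'                                   ∎)
    where open ≋-Reasoning

  affine-inverse : ∀ s z z' w → affine s z' z (affine s z z' w) ≡ w
  affine-inverse s z z' w = affine-≡ s z' z (begin
    val w - val z                                         ≡⟨ ℤₚ.*-identityˡ (val w - val z) ⟨
    1ℤ * (val w - val z)                                  ≡⟨ ≡.cong (_* (val w - val z)) (sign-unit² s) ⟨
    (sign-unit s * sign-unit s) * (val w - val z)         ≡⟨ ℤₚ.*-assoc (sign-unit s) (sign-unit s) _ ⟩
    sign-unit s * (sign-unit s * (val w - val z))         ≈⟨ *-congˡ-≋ (sign-unit s) (≋-sym (affine-≋ s z z' w)) ⟩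
    sign-unit s * (val (affine s z z' w) - val z')        ∎)
    where open ≋-Reasoning

  affine-preserves-dist : ∀ s z z' a b → dist (affine s z z' a) (affine s z z' b) ≡ dist a b
  affine-preserves-dist s z z' a b = ≋±⇒dist≡ _ _ a b (≋±-trans (inj₁ (begin
    val σa - val σb                                             ≡⟨ [a-c]-[b-c]≡a-b (val σa) (val σb) (val z') ⟨
    (val σa - val z') - (val σb - val z')                       ≈⟨ minus-cong-≋ (affine-≋ s z z' a) (affine-≋ s z z' b) ⟩
    sign-unit s * (val a - val z) - sign-unit s * (val b - val z) ≡⟨ ca-cb≡c[a-b] (val a - val z) (val b - val z) (sign-unit s) ⟩
    sign-unit s * ((val a - val z) - (val b - val z))           ≡⟨ ≡.cong (sign-unit s *_) ([a-c]-[b-c]≡a-b (val a) (val b) (val z)) ⟩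
    sign-unit s * (val a - val b)                               ∎))
    (sign-unit-≋± s (val a - val b)))
    where
    open ≋-Reasoning
    σa σb : Fin N
    σa = affine s z z' a
    σb = affine s z z' b

  dihedral : Sign → Fin N → Fin N → Isometry
  dihedral s z z' = record
    { π              = permutation (affine s z z') (affine s z' z) (affine-inverse s z' z) (affine-inverse s z z')
    ; preserves-dist = affine-preserves-dist s z z'
    }

  triangle-congruence : ∀ x y z x' y' z' →
    dist y z ≡ dist y' z' → dist x z ≡ dist x' z' → dist x y ≡ dist x' y' →
    Σ Isometry λ σ → let open Isometry σ in
      π ⟨$⟩ʳ x ≡ x' × π ⟨$⟩ʳ y ≡ y' × π ⟨$⟩ʳ z ≡ z'
  triangle-congruence x y z x' y' z' yz xz xy = congruent (±-rigidity
    (dist≡⇒≋± x' z' x z (≡.sym xz))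
    (dist≡⇒≋± y' z' y z (≡.sym yz))
    (≡.subst₂ _≋±_ (≡.sym ([a-c]-[b-c]≡a-b (val x') (val y') (val z')))
                 (≡.sym ([a-c]-[b-c]≡a-b (val x) (val y) (val z)))
                 (dist≡⇒≋± x' y' x y (≡.sym xy))))
    where
    congruent : Signed (val x - val z) (val y - val z) (val x' - val z') (val y' - val z') →
                Σ Isometry λ σ → let open Isometry σ in
                  π ⟨$⟩ʳ x ≡ x' × π ⟨$⟩ʳ y ≡ y' × π ⟨$⟩ʳ z ≡ z'
    congruent (s , p , q) = dihedral s z z' , affine-≡ s z z' p , affine-≡ s z z' q , affine-≡ s z z' z'-z'≋
      where
      z'-z'≋ : val z' - val z' ≋ sign-unit s * (val z - val z)
      z'-z'≋ = ≋-reflexive (≡.trans (ℤₚ.+-inverseʳ (val z'))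
                 (≡.sym (≡.trans (≡.cong (sign-unit s *_) (ℤₚ.+-inverseʳ (val z))) (ℤₚ.*-zeroʳ (sign-unit s)))))

  translation : Permutation′ N
  translation = Isometry.π (dihedral Sign.+ origin (fromℤ 1ℤ))

  translation-≋ : ∀ w → val (translation ⟨$⟩ʳ w) ≋ val w + 1ℤ
  translation-≋ w = begin
    val τw                                   ≡⟨ [a-b]+b≡a (val τw) (val one) ⟨
    (val τw - val one) + val one             ≈⟨ +-cong-≋ (affine-≋ Sign.+ origin one w) (val-fromℤ 1ℤ) ⟩
    1ℤ * (val w - val origin) + 1ℤ           ≡⟨ ≡.cong (_+ 1ℤ) (ℤₚ.*-identityˡ (val w - val origin)) ⟩
    (val w - val origin) + 1ℤ                ≈⟨ +-cong-≋ (val-origin (val w)) (≋-refl {1ℤ}) ⟩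
    val w + 1ℤ                               ∎
    where
    open ≋-Reasoning
    one τw : Fin N
    one = fromℤ 1ℤ
    τw = translation ⟨$⟩ʳ w

𝟙ℕ : ∀ {p} {P : Set p} → Dec P → ℕ
𝟙ℕ (yes _) = 1
𝟙ℕ (no _)  = 0

𝟙ℕ≢0⇒ : ∀ {p} {P : Set p} (d : Dec P) → 𝟙ℕ d ≢ 0 → P
𝟙ℕ≢0⇒ (yes p) _   = p
𝟙ℕ≢0⇒ (no _)  0≢0 = ⊥-elim (0≢0 ≡.refl)

⇒𝟙ℕ≢0 : ∀ {p} {P : Set p} (d : Dec P) → P → 𝟙ℕ d ≢ 0
⇒𝟙ℕ≢0 (yes _) _ ()
⇒𝟙ℕ≢0 (no ¬p) p = ⊥-elim (¬p p)

sumℕ : ∀ {n} → (Fin n → ℕ) → ℕ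
sumℕ = MonoidSum.sum ℕₚ.+-0-monoid

sumℕ≢0⇒ : ∀ {n} (f : Fin n → ℕ) → sumℕ f ≢ 0 → ∃ λ i → f i ≢ 0
sumℕ≢0⇒ {zero}  f sum≢0 = ⊥-elim (sum≢0 ≡.refl)
sumℕ≢0⇒ {suc n} f sum≢0 with f Fin.zero ℕ.≟ 0
... | no  f0≢0 = Fin.zero , f0≢0
... | yes f0≡0 with sumℕ≢0⇒ (f ∘ Fin.suc) (λ rest≡0 → sum≢0 (≡.cong₂ ℕ._+_ f0≡0 rest≡0))
...   | i , fi≢0 = Fin.suc i , fi≢0

⇒sumℕ≢0 : ∀ {n} (f : Fin n → ℕ) i → f i ≢ 0 → sumℕ f ≢ 0
⇒sumℕ≢0 {suc n} f Fin.zero    f0≢0 sum≡0 = f0≢0 (ℕₚ.m+n≡0⇒m≡0 (f Fin.zero) sum≡0)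
⇒sumℕ≢0 {suc n} f (Fin.suc i) fi≢0 sum≡0 =
  ⇒sumℕ≢0 (f ∘ Fin.suc) i fi≢0 (ℕₚ.m+n≡0⇒n≡0 (f Fin.zero) sum≡0)

module RingFacts {c ℓ} (R : CommutativeRing c ℓ) where
  open CommutativeRing R
  open RingProperties ring using (//-rightDividesˡ)
  open SemiringSum semiring public
    using (sum; sum-cong-≋; ∑-comm; ∑-distrib-+; *-distribˡ-sum; *-distribʳ-sum; sum-permute)
  open SemiringSum semiring using (sum-remove; sum-replicate; sum-replicate-zero)
  open SemiringMult semiring using (×-homo-+) renaming (_×_ to _×ₙ_)
  open SemiringExp semiring using (_^_; ^-homo-*)
  open SetoidReasoning setoid

  sumF≡sum : ∀ {n} (f : Fin n → Carrier) → sumF R f ≡ sum f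
  sumF≡sum {zero}  f = ≡.refl
  sumF≡sum {suc n} f = ≡.cong (λ t → f Fin.zero + t) (sumF≡sum (λ i → f (Fin.suc i)))

  sum-zero : ∀ {n} {f : Fin n → Carrier} → (∀ i → f i ≈ 0#) → sum f ≈ 0#
  sum-zero {n} f≈0 = trans (sum-cong-≋ f≈0) (sum-replicate-zero n)

  sum-δ : ∀ {n} (f : Fin n → Carrier) i → (∀ j → j ≢ i → f j ≈ 0#) → sum f ≈ f i
  sum-δ {suc n} f i f≈0 = begin
    sum f                             ≈⟨ sum-remove {i = i} f ⟩
    f i + sum (f ∘ punchIn i)         ≈⟨ +-congˡ (sum-zero (λ j → f≈0 (punchIn i j) (Finₚ.punchInᵢ≢i i j))) ⟩
    f i + 0#                          ≈⟨ +-identityʳ (f i) ⟩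
    f i                               ∎

  natR≡×1 : ∀ n → natR R n ≡ n ×ₙ 1#
  natR≡×1 zero    = ≡.refl
  natR≡×1 (suc n) = ≡.cong (λ t → 1# + t) (natR≡×1 n)

  natR-+ : ∀ m n → natR R (m ℕ.+ n) ≈ natR R m + natR R n
  natR-+ m n rewrite natR≡×1 (m ℕ.+ n) | natR≡×1 m | natR≡×1 n = ×-homo-+ 1# m n

  sum-1# : ∀ n → sum (λ (_ : Fin n) → 1#) ≈ natR R n
  sum-1# n = trans (sum-replicate n) (reflexive (≡.sym (natR≡×1 n)))

  pow≡^ : ∀ x n → pow R x n ≡ x ^ n
  pow≡^ x zero    = ≡.refl
  pow≡^ x (suc n) = ≡.cong (x *_) (pow≡^ x n)

  pow-+ : ∀ x m n → pow R x (m ℕ.+ n) ≈ pow R x m * pow R x n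
  pow-+ x m n rewrite pow≡^ x (m ℕ.+ n) | pow≡^ x m | pow≡^ x n = ^-homo-* x m n

  natR-sumℕ : ∀ {n} (f : Fin n → ℕ) → natR R (sumℕ f) ≈ sum (natR R ∘ f)
  natR-sumℕ {zero}  f = refl
  natR-sumℕ {suc n} f = trans (natR-+ (f Fin.zero) (sumℕ (f ∘ Fin.suc)))
                              (+-congˡ (natR-sumℕ (f ∘ Fin.suc)))

  𝟙 : ∀ {p} {P : Set p} → Dec P → Carrier
  𝟙 (yes _) = 1#
  𝟙 (no _)  = 0#

  𝟙-yes : ∀ {p} {P : Set p} (d : Dec P) → P → 𝟙 d ≈ 1#
  𝟙-yes (yes _) _ = refl
  𝟙-yes (no ¬p) p = ⊥-elim (¬p p)

  𝟙-no : ∀ {p} {P : Set p} (d : Dec P) → ¬ P → 𝟙 d ≈ 0#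
  𝟙-no (yes p) ¬p = ⊥-elim (¬p p)
  𝟙-no (no _)  _  = refl

  natR-𝟙ℕ : ∀ {p} {P : Set p} (d : Dec P) → natR R (𝟙ℕ d) ≈ 𝟙 d
  natR-𝟙ℕ (yes _) = +-identityʳ 1#
  natR-𝟙ℕ (no _)  = refl

  𝟙-×-dec : ∀ {p q} {P : Set p} {Q : Set q} (d : Dec P) (e : Dec Q) → 𝟙 (d ×-dec e) ≈ 𝟙 d * 𝟙 e
  𝟙-×-dec (yes _) (yes _) = sym (*-identityˡ 1#)
  𝟙-×-dec (yes _) (no _)  = sym (zeroʳ 1#)
  𝟙-×-dec (no _)  _       = sym (zeroˡ _)

  sum-select : ∀ {n} (f : Fin n → Carrier) i → sum (λ j → 𝟙 (j Fin.≟ i) * f j) ≈ f i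
  sum-select f i = begin
    sum (λ j → 𝟙 (j Fin.≟ i) * f j)    ≈⟨ sum-δ _ i (λ j j≢i → trans (*-congʳ (𝟙-no (j Fin.≟ i) j≢i)) (zeroˡ (f j))) ⟩
    𝟙 (i Fin.≟ i) * f i                ≈⟨ *-congʳ (𝟙-yes (i Fin.≟ i) ≡.refl) ⟩
    1# * f i                           ≈⟨ *-identityˡ (f i) ⟩
    f i                                ∎

  [a-b]x+bx≈ax : ∀ a b x → (a - b) * x + b * x ≈ a * x
  [a-b]x+bx≈ax a b x = trans (sym (distribʳ x (a - b) b)) (*-congʳ (//-rightDividesˡ b a))

module FieldFacts {c ℓ} (R : CommutativeRing c ℓ) (isField : IsField R) where
  open CommutativeRing R
  open RingFacts R
  open RingProperties ring using (x∙y⁻¹≈ε⇒x≈y; +-cancelʳ)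
  module +-CS = CommutativeSemigroupProperties +-commutativeSemigroup
  open SetoidReasoning setoid

  1≉0 : ¬ 1# ≈ 0#
  1≉0 = proj₁ isField

  ≉0⇒cancel : ∀ {a u} → ¬ a ≈ 0# → a * u ≈ 0# → u ≈ 0#
  ≉0⇒cancel {a} {u} a≉0 au≈0 with proj₂ isField a a≉0
  ... | a⁻¹ , aa⁻¹≈1 = begin
    u                 ≈⟨ *-identityˡ u ⟨
    1# * u            ≈⟨ *-congʳ aa⁻¹≈1 ⟨
    (a * a⁻¹) * u     ≈⟨ *-congʳ (*-comm a a⁻¹) ⟩
    (a⁻¹ * a) * u     ≈⟨ *-assoc a⁻¹ a u ⟩
    a⁻¹ * (a * u)     ≈⟨ *-congˡ au≈0 ⟩
    a⁻¹ * 0#          ≈⟨ zeroʳ a⁻¹ ⟩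
    0#                ∎

  *-≉0 : ∀ {a b} → ¬ a ≈ 0# → ¬ b ≈ 0# → ¬ a * b ≈ 0#
  *-≉0 a≉0 b≉0 ab≈0 = b≉0 (≉0⇒cancel a≉0 ab≈0)

  *-cancelˡ-≉0 : ∀ {a u v} → ¬ a ≈ 0# → a * u ≈ a * v → u ≈ v
  *-cancelˡ-≉0 {a} {u} {v} a≉0 au≈av = x∙y⁻¹≈ε⇒x≈y u v (≉0⇒cancel a≉0 (begin
    a * (u - v)       ≈⟨ distribˡ a u (- v) ⟩
    a * u + a * - v   ≈⟨ +-congʳ au≈av ⟩
    a * v + a * - v   ≈⟨ distribˡ a v (- v) ⟨
    a * (v - v)       ≈⟨ *-congˡ (-‿inverseʳ v) ⟩
    a * 0#            ≈⟨ zeroʳ a ⟩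
    0#                ∎))

  -- The hypothesis says (a - b)(u - v) = 0.
  cross-cancel : ∀ {a b u v} → ¬ a ≈ b → a * u + b * v ≈ b * u + a * v → u ≈ v
  cross-cancel {a} {b} {u} {v} a≉b h = *-cancelˡ-≉0 a-b≉0 (+-cancelʳ (b * u + b * v) _ _ (begin
    (a - b) * u + (b * u + b * v)   ≈⟨ +-assoc _ _ _ ⟨
    ((a - b) * u + b * u) + b * v   ≈⟨ +-congʳ ([a-b]x+bx≈ax a b u) ⟩
    a * u + b * v                   ≈⟨ h ⟩
    b * u + a * v                   ≈⟨ +-congˡ ([a-b]x+bx≈ax a b v) ⟨
    b * u + ((a - b) * v + b * v)   ≈⟨ +-CS.x∙yz≈y∙xz _ _ _ ⟩
    (a - b) * v + (b * u + b * v)   ∎))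
    where
    a-b≉0 : ¬ a - b ≈ 0#
    a-b≉0 = a≉b ∘ x∙y⁻¹≈ε⇒x≈y a b

  distinct-eigenvalues : ∀ {a b u} → ¬ a ≈ b → a * u ≈ b * u → u ≈ 0#
  distinct-eigenvalues {a} {b} {u} a≉b au≈bu = cross-cancel a≉b (begin
    a * u + b * 0#    ≈⟨ +-cong au≈bu (zeroʳ b) ⟩
    b * u + 0#        ≈⟨ +-congˡ (zeroʳ a) ⟨
    b * u + a * 0#    ∎)

-- Characters of ℤ/N

module Characters {c ℓ} (R : CommutativeRing c ℓ) (isField : IsField R)
                  (N : ℕ) .{{_ : NonZero N}}
                  (ζ : CommutativeRing.Carrier R) (ζ-primitive : IsPrimitiveRoot R N ζ) where
  open CommutativeRing R
  open RingFacts R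
  open FieldFacts R isField
  open Modular N
  open SetoidReasoning setoid

  pow-multiple : ∀ k → pow R ζ (k ℕ.* N) ≈ 1#
  pow-multiple zero    = refl
  pow-multiple (suc k) = begin
    pow R ζ (N ℕ.+ k ℕ.* N)              ≈⟨ pow-+ ζ N (k ℕ.* N) ⟩
    pow R ζ N * pow R ζ (k ℕ.* N)        ≈⟨ *-cong (proj₁ ζ-primitive) (pow-multiple k) ⟩
    1# * 1#                              ≈⟨ *-identityˡ 1# ⟩
    1#                                   ∎

  pow-%N : ∀ m → pow R ζ (m % N) ≈ pow R ζ m
  pow-%N m = sym (begin
    pow R ζ m                                   ≡⟨ ≡.cong (pow R ζ) (m≡m%n+[m/n]*n m N) ⟩
    pow R ζ (m % N ℕ.+ m ℕ./ N ℕ.* N)           ≈⟨ pow-+ ζ (m % N) (m ℕ./ N ℕ.* N) ⟩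
    pow R ζ (m % N) * pow R ζ (m ℕ./ N ℕ.* N)   ≈⟨ *-congˡ (pow-multiple (m ℕ./ N)) ⟩
    pow R ζ (m % N) * 1#                        ≈⟨ *-identityʳ _ ⟩
    pow R ζ (m % N)                             ∎)

  e : ℤ → Carrier
  e a = pow R ζ (a %ℕ N)

  e-pos : ∀ m → e (+ m) ≈ pow R ζ m
  e-pos = pow-%N

  e-cong : ∀ {a b} → a ≋ b → e a ≈ e b
  e-cong a≋b = reflexive (≡.cong (pow R ζ) (≋⇒%ℕ≡ a≋b))

  e-homo : ∀ a b → e (a ℤ.+ b) ≈ e a * e b
  e-homo a b = begin
    e (a ℤ.+ b)                        ≈⟨ e-cong (+-cong-≋ (≋-sym (%ℕ-≋ a)) (≋-sym (%ℕ-≋ b))) ⟩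
    e (+ (a %ℕ N) ℤ.+ + (b %ℕ N))      ≡⟨ ≡.cong e (ℤₚ.pos-+ (a %ℕ N) (b %ℕ N)) ⟨
    e (+ (a %ℕ N ℕ.+ b %ℕ N))          ≈⟨ e-pos (a %ℕ N ℕ.+ b %ℕ N) ⟩
    pow R ζ (a %ℕ N ℕ.+ b %ℕ N)        ≈⟨ pow-+ ζ (a %ℕ N) (b %ℕ N) ⟩
    e a * e b                          ∎

  e-zero : e 0ℤ ≈ 1#
  e-zero = reflexive (≡.cong (pow R ζ) (m*n%n≡0 0 N))

  e≈1⇒≋0 : ∀ a → e a ≈ 1# → a ≋ 0ℤ
  e≈1⇒≋0 a ea≈1 with a %ℕ N in eq
  ... | zero  = ≋-trans (≋-sym (%ℕ-≋ a)) (≋-reflexive (≡.cong +_ eq))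
  ... | suc k = ⊥-elim (proj₂ ζ-primitive (suc k) (s≤s z≤n) (≡.subst (ℕ._< N) eq (%ℕ<N a)) ea≈1)

  e-inverse : ∀ a → e a * e (ℤ.- a) ≈ 1#
  e-inverse a = trans (sym (e-homo a (ℤ.- a))) (trans (e-cong (≋-reflexive (ℤₚ.+-inverseʳ a))) e-zero)

  e-injective : ∀ {a b} → e a ≈ e b → a ≋ b
  e-injective {a} {b} ea≈eb = ≋0⇒≋ (e≈1⇒≋0 (a ℤ.- b) (begin
    e (a ℤ.- b)          ≈⟨ e-homo a (ℤ.- b) ⟩
    e a * e (ℤ.- b)      ≈⟨ *-congʳ ea≈eb ⟩
    e b * e (ℤ.- b)      ≈⟨ e-inverse b ⟩
    1#                   ∎))

  character-sum-≋0 : ∀ s → s ≋ 0ℤ → sum (λ x → e (s ℤ.* val x)) ≈ natR R N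
  character-sum-≋0 s s≋0 = begin
    sum (λ x → e (s ℤ.* val x))     ≈⟨ sum-cong-≋ (λ x → trans (e-cong (s*x≋0 x)) e-zero) ⟩
    sum (λ (_ : Fin N) → 1#)         ≈⟨ sum-1# N ⟩
    natR R N                         ∎
    where
    s*x≋0 : ∀ x → s ℤ.* val x ≋ 0ℤ
    s*x≋0 x = ≋-trans (≋-reflexive (ℤₚ.*-comm s (val x)))
                (≋-trans (*-congˡ-≋ (val x) s≋0) (≋-reflexive (ℤₚ.*-zeroʳ (val x))))

  -- Translating x ↦ x + 1 permutes the terms and multiplies each by e s.
  character-sum-≉0 : ∀ s → ¬ s ≋ 0ℤ → sum (λ x → e (s ℤ.* val x)) ≈ 0#
  character-sum-≉0 s s≉0 = distinct-eigenvalues (s≉0 ∘ e≈1⇒≋0 s) (begin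
    e s * S                                          ≈⟨ *-distribˡ-sum (e s) (λ x → e (s ℤ.* val x)) ⟩
    sum (λ x → e s * e (s ℤ.* val x))                ≈⟨ sum-cong-≋ (λ x → sym (e-homo s (s ℤ.* val x))) ⟩
    sum (λ x → e (s ℤ.+ s ℤ.* val x))                ≈⟨ sum-cong-≋ (λ x → e-cong (shift x)) ⟩
    sum (λ x → e (s ℤ.* val (translation ⟨$⟩ʳ x)))   ≈⟨ sum-permute (λ x → e (s ℤ.* val x)) translation ⟨
    S                                                ≈⟨ *-identityˡ S ⟨
    1# * S                                           ∎)
    where
    S : Carrier
    S = sum (λ x → e (s ℤ.* val x))
    shift : ∀ x → s ℤ.+ s ℤ.* val x ≋ s ℤ.* val (translation ⟨$⟩ʳ x)
    shift x = ≋-trans (≋-reflexive (s+sx≡s[x+1] s (val x)))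
                      (*-congˡ-≋ s (≋-sym (translation-≋ x)))
      where
      s+sx≡s[x+1] : ∀ s x → s ℤ.+ s ℤ.* x ≡ s ℤ.* (x ℤ.+ 1ℤ)
      s+sx≡s[x+1] = solve-∀

  Θ : ℤ → Carrier
  Θ a = e a + e (ℤ.- a)

  pow+pow≈Θ : ∀ {i} → i ℕ.≤ N → pow R ζ i + pow R ζ (N ∸ i) ≈ Θ (+ i)
  pow+pow≈Θ {i} i≤N = +-cong (sym (e-pos i)) (trans (sym (e-pos (N ∸ i))) (e-cong (N∸r≋-r i≤N)))

  Θ-cong : ∀ {a b} → a ≋± b → Θ a ≈ Θ b
  Θ-cong (inj₁ a≋b)  = +-cong (e-cong a≋b) (e-cong (neg-cong-≋ a≋b))
  Θ-cong (inj₂ a≋-b) = trans (+-cong (e-cong a≋-b) (e-cong (≋-neg-neg a≋-b))) (+-comm _ _)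

  -- If e a + e a⁻¹ = e b + e b⁻¹ and e a ≠ e b then e a e b = 1.
  Θ-injective : ∀ a b → Θ a ≈ Θ b → a ≋± b
  Θ-injective a b Θa≈Θb with ≋-dec a b
  ... | yes a≋b = inj₁ a≋b
  ... | no  a≉b = inj₂ (+≋0⇒≋- (e≈1⇒≋0 (a ℤ.+ b) (trans (e-homo a b) AB≈1)))
    where
    A A⁻¹ B B⁻¹ : Carrier
    A = e a
    A⁻¹ = e (ℤ.- a)
    B = e b
    B⁻¹ = e (ℤ.- b)
    cancel : ∀ {x x⁻¹} y → x * x⁻¹ ≈ 1# → x⁻¹ * (x * y) ≈ y
    cancel {x} {x⁻¹} y xx⁻¹≈1 = begin
      x⁻¹ * (x * y)    ≈⟨ *-assoc x⁻¹ x y ⟨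
      (x⁻¹ * x) * y    ≈⟨ *-congʳ (trans (*-comm x⁻¹ x) xx⁻¹≈1) ⟩
      1# * y           ≈⟨ *-identityˡ y ⟩
      y                ∎
    AB≈1 : A * B ≈ 1#
    AB≈1 = cross-cancel (a≉b ∘ e-injective) (begin
      A * (A * B) + B * 1#              ≈⟨ +-congˡ (trans (*-identityʳ B) (sym (cancel B (e-inverse a)))) ⟩
      A * (A * B) + A⁻¹ * (A * B)       ≈⟨ distribʳ (A * B) A A⁻¹ ⟨
      Θ a * (A * B)                     ≈⟨ *-congʳ Θa≈Θb ⟩
      Θ b * (A * B)                     ≈⟨ distribʳ (A * B) B B⁻¹ ⟩
      B * (A * B) + B⁻¹ * (A * B)       ≈⟨ +-congˡ (trans (*-congˡ (*-comm A B)) (cancel A (e-inverse b))) ⟩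
      B * (A * B) + A                   ≈⟨ +-congˡ (*-identityʳ A) ⟨
      B * (A * B) + A * 1#              ∎)

Enumerates : ∀ {a p} {A : Set a} → Pred A p → ℕ → Set (a ⊔ p)
Enumerates {A = A} P d = Σ (Fin d → A) λ f →
    (∀ k → P (f k))
  × (∀ k l → f k ≡ f l → k ≡ l)
  × (∀ t → P t → ∃ λ k → f k ≡ t)

enumerate-Fin : ∀ {m p} {P : Pred (Fin m) p} → Decidable P → ∃ (Enumerates P)
enumerate-Fin {zero}  P? = 0 , (λ ()) , (λ ()) , (λ ()) , (λ ())
enumerate-Fin {suc m} {P = P} P? with enumerate-Fin (P? ∘ Fin.suc)
... | d , f , f-ok , f-inj , f-onto with P? Fin.zero
...   | yes P0 = suc d , g , g-ok , g-inj , g-onto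
  where
  g : Fin (suc d) → Fin (suc m)
  g Fin.zero    = Fin.zero
  g (Fin.suc k) = Fin.suc (f k)
  g-ok : ∀ k → P (g k)
  g-ok Fin.zero    = P0
  g-ok (Fin.suc k) = f-ok k
  g-inj : ∀ k l → g k ≡ g l → k ≡ l
  g-inj Fin.zero    Fin.zero    _  = ≡.refl
  g-inj (Fin.suc k) (Fin.suc l) eq = ≡.cong Fin.suc (f-inj k l (Finₚ.suc-injective eq))
  g-onto : ∀ t → P t → ∃ λ k → g k ≡ t
  g-onto Fin.zero    _  = Fin.zero , ≡.refl
  g-onto (Fin.suc t) Pt = let k , fk≡t = f-onto t Pt in Fin.suc k , ≡.cong Fin.suc fk≡t
...   | no ¬P0 = d , Fin.suc ∘ f , f-ok , g-inj , g-onto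
  where
  g-inj : ∀ k l → Fin.suc (f k) ≡ Fin.suc (f l) → k ≡ l
  g-inj k l eq = f-inj k l (Finₚ.suc-injective eq)
  g-onto : ∀ t → P t → ∃ λ k → Fin.suc (f k) ≡ t
  g-onto Fin.zero    P0 = ⊥-elim (¬P0 P0)
  g-onto (Fin.suc t) Pt = let k , fk≡t = f-onto t Pt in k , ≡.cong Fin.suc fk≡t

enumerate-↔ : ∀ {a p m} {A : Set a} {P : Pred A p} → A ↔ Fin m → Decidable P → ∃ (Enumerates P)
enumerate-↔ {P = P} A↔Fin P? = transfer (enumerate-Fin (P? ∘ from))
  where
  open Inverse A↔Fin
  transfer : ∃ (Enumerates (P ∘ from)) → ∃ (Enumerates P)
  transfer (d , f , f-ok , f-inj , f-onto) = d , from ∘ f , f-ok , g-inj , g-onto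
    where
    g-inj : ∀ k l → from (f k) ≡ from (f l) → k ≡ l
    g-inj k l eq = f-inj k l (≡.trans (≡.sym (strictlyInverseˡ (f k)))
                            (≡.trans (≡.cong to eq) (strictlyInverseˡ (f l))))
    g-onto : ∀ t → P t → ∃ λ k → from (f k) ≡ t
    g-onto t Pt = let k , fk≡to-t = f-onto (to t) (≡.subst P (≡.sym (strictlyInverseʳ t)) Pt)
                  in k , ≡.trans (≡.cong from fk≡to-t) (strictlyInverseʳ t)

Fin³↔Fin : ∀ s → (Fin s × Fin s × Fin s) ↔ Fin (s ℕ.* (s ℕ.* s))
Fin³↔Fin s = ↔-sym (↔-trans Finₚ.*↔× (↔-refl ×-↔ Finₚ.*↔×))

-- The cycle graph

module CycleGraph (N D : ℕ) .{{_ : NonZero N}}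
                  (2D≤N : D ℕ.+ D ℕ.≤ N) (N≤2D+1 : N ℕ.≤ suc (D ℕ.+ D)) (3≤N : 3 ℕ.≤ N) where
  open Modular N
  open Bounded D 2D≤N N≤2D+1
  open IntegerIdentities

  1≤D : 1 ℕ.≤ D
  1≤D = ℕₚ.n≢0⇒n>0 D≢0
    where
    D≢0 : D ≢ 0
    D≢0 D≡0 with ≡.subst (λ d → 3 ℕ.≤ suc (d ℕ.+ d)) D≡0 (ℕₚ.≤-trans 3≤N N≤2D+1)
    ... | s≤s ()

  next prev : Fin N → Fin N
  next x = fromℤ (val x ℤ.+ 1ℤ)
  prev x = fromℤ (val x ℤ.- 1ℤ)

  dist-next : ∀ x → dist x (next x) ≡ 1
  dist-next x = ≋±⇒dist≡ᴰ x (next x) 1≤D (inj₂ (begin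
    val x ℤ.- val (next x)         ≈⟨ minus-cong-≋ (≋-refl {val x}) (val-fromℤ (val x ℤ.+ 1ℤ)) ⟩
    val x ℤ.- (val x ℤ.+ 1ℤ)       ≡⟨ a-[a+b]≡-b (val x) 1ℤ ⟩
    ℤ.- 1ℤ                         ∎))
    where open ≋-Reasoning

  dist-prev : ∀ x → dist x (prev x) ≡ 1
  dist-prev x = ≋±⇒dist≡ᴰ x (prev x) 1≤D (inj₁ (begin
    val x ℤ.- val (prev x)         ≈⟨ minus-cong-≋ (≋-refl {val x}) (val-fromℤ (val x ℤ.- 1ℤ)) ⟩
    val x ℤ.- (val x ℤ.- 1ℤ)       ≡⟨ a-[a-b]≡b (val x) 1ℤ ⟩
    1ℤ                             ∎))
    where open ≋-Reasoning

  adjacent⇒next⊎prev : ∀ x y → dist x y ≡ 1 → y ≡ next x ⊎ y ≡ prev x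
  adjacent⇒next⊎prev x y d≡1 = neighbour (≡.subst (λ d → val x ℤ.- val y ≋± + d) d≡1 (dist≋± x y))
    where
    open ≋-Reasoning
    neighbour : val x ℤ.- val y ≋± 1ℤ → y ≡ next x ⊎ y ≡ prev x
    neighbour (inj₁ x-y≋1)  = inj₂ (≡.sym (fromℤ-≋ {val x ℤ.- 1ℤ} (begin
      val x ℤ.- 1ℤ                   ≈⟨ minus-cong-≋ (≋-refl {val x}) (≋-sym x-y≋1) ⟩
      val x ℤ.- (val x ℤ.- val y)    ≡⟨ a-[a-b]≡b (val x) (val y) ⟩
      val y                          ∎)))
    neighbour (inj₂ x-y≋-1) = inj₁ (≡.sym (fromℤ-≋ {val x ℤ.+ 1ℤ} (begin
      val x ℤ.- -1ℤ                  ≈⟨ minus-cong-≋ (≋-refl {val x}) (≋-sym x-y≋-1) ⟩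
      val x ℤ.- (val x ℤ.- val y)    ≡⟨ a-[a-b]≡b (val x) (val y) ⟩
      val y                          ∎)))

  -- x + 1 ≡ x - 1 would give N ∣ 2, excluded by 3 ≤ N.
  next≢prev : ∀ x → next x ≢ prev x
  next≢prev x next≡prev = 2≢0 (canonical 2<N 0<N 2≋0)
    where
    open ≋-Reasoning
    2≢0 : 2 ≢ 0
    2≢0 ()
    2<N : 2 ℕ.< N
    2<N = 3≤N
    0<N : 0 ℕ.< N
    0<N = ℕₚ.≤-trans (s≤s z≤n) 3≤N
    [a+1]-[a-1]≡2 : ∀ a → (a ℤ.+ 1ℤ) ℤ.- (a ℤ.- 1ℤ) ≡ + 2
    [a+1]-[a-1]≡2 = solve-∀
    2≋0 : + 2 ≋ 0ℤ
    2≋0 = begin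
      + 2                                        ≡⟨ [a+1]-[a-1]≡2 (val x) ⟨
      (val x ℤ.+ 1ℤ) ℤ.- (val x ℤ.- 1ℤ)          ≈⟨ minus-cong-≋ (val-fromℤ (val x ℤ.+ 1ℤ)) (val-fromℤ (val x ℤ.- 1ℤ)) ⟨
      val (next x) ℤ.- val (prev x)              ≡⟨ ≡.cong (λ y → val y ℤ.- val (prev x)) next≡prev ⟩
      val (prev x) ℤ.- val (prev x)              ≡⟨ ℤₚ.+-inverseʳ (val (prev x)) ⟩
      0ℤ                                         ∎

  -- h = a + b with a = ±i and b = ±j; count t turns out to be the Krein parameter q^h_ij.
  Decomposition : Fin (suc D) × Fin (suc D) × Fin (suc D) → Fin N → Fin N → Set
  Decomposition (h , i , j) a b = val a ≋± + toℕ i × val b ≋± + toℕ j × val a ℤ.+ val b ≋ + toℕ h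

  decomposition? : ∀ t a b → Dec (Decomposition t a b)
  decomposition? (h , i , j) a b =
    ≋±-dec (val a) (+ toℕ i) ×-dec ≋±-dec (val b) (+ toℕ j) ×-dec ≋-dec (val a ℤ.+ val b) (+ toℕ h)

  count : Fin (suc D) × Fin (suc D) × Fin (suc D) → ℕ
  count t = sumℕ (λ a → sumℕ (λ b → 𝟙ℕ (decomposition? t a b)))

  idx≤D : (k : Fin (suc D)) → toℕ k ℕ.≤ D
  idx≤D k = ℕₚ.≤-pred (Finₚ.toℕ<n k)

  profile : Fin N → Fin N → Fin N → ℕ × ℕ × ℕ
  profile x y z = dist y z , dist x z , dist x y

  toℕ³ : Fin (suc D) × Fin (suc D) × Fin (suc D) → ℕ × ℕ × ℕ
  toℕ³ (h , i , j) = toℕ h , toℕ i , toℕ j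

  toℕ³-injective : ∀ s t → toℕ³ s ≡ toℕ³ t → s ≡ t
  toℕ³-injective (h , i , j) (h' , i' , j') eq = ≡.cong₂ _,_ (Finₚ.toℕ-injective (≡.cong proj₁ eq))
    (≡.cong₂ _,_ (Finₚ.toℕ-injective (≡.cong (proj₁ ∘ proj₂) eq)) (Finₚ.toℕ-injective (≡.cong (proj₂ ∘ proj₂) eq)))

  decomposition⇒profile : ∀ t a b → Decomposition t a b →
    profile a (fromℤ (val a ℤ.+ val b)) origin ≡ toℕ³ t
  decomposition⇒profile (h , i , j) a b (a≋±i , b≋±j , a+b≋h) =
    ≡.cong₂ _,_ dist-yz (≡.cong₂ _,_ dist-xz dist-xy)
    where
    y : Fin N
    y = fromℤ (val a ℤ.+ val b)
    dist-yz : dist y origin ≡ toℕ h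
    dist-yz = ≋±⇒dist≡ᴰ y origin (idx≤D h)
      (inj₁ (≋-trans (val-origin (val y)) (≋-trans (val-fromℤ (val a ℤ.+ val b)) a+b≋h)))
    dist-xz : dist a origin ≡ toℕ i
    dist-xz = ≋±⇒dist≡ᴰ a origin (idx≤D i) (≋±-trans (inj₁ (val-origin (val a))) a≋±i)
    dist-xy : dist a y ≡ toℕ j
    dist-xy = ≋±⇒dist≡ᴰ a y (idx≤D j) (≋±-trans (inj₁ a-y≋-b) (≋±-negˡ b≋±j))
      where
      a-y≋-b : val a ℤ.- val y ≋ ℤ.- val b
      a-y≋-b = ≋-trans (minus-cong-≋ (≋-refl {val a}) (val-fromℤ (val a ℤ.+ val b)))
                       (≋-reflexive (a-[a+b]≡-b (val a) (val b)))

  profile⇒decomposition : ∀ x y z t → profile x y z ≡ toℕ³ t → ∃₂ (Decomposition t)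
  profile⇒decomposition x y z (h , i , j) eq =
    split (≡.subst (λ d → val y ℤ.- val z ≋± + d) (≡.cong proj₁ eq) (dist≋± y z))
    where
    x-z≋±i : val x ℤ.- val z ≋± + toℕ i
    x-z≋±i = ≡.subst (λ d → val x ℤ.- val z ≋± + d) (≡.cong (proj₁ ∘ proj₂) eq) (dist≋± x z)
    x-y≋±j : val x ℤ.- val y ≋± + toℕ j
    x-y≋±j = ≡.subst (λ d → val x ℤ.- val y ≋± + d) (≡.cong (proj₂ ∘ proj₂) eq) (dist≋± x y)
    negated : ∀ u v {k} → u ℤ.- v ≋± k → val (fromℤ (v ℤ.- u)) ≋± k
    negated u v p = ≋±-trans (inj₁ (≋-trans (val-fromℤ (v ℤ.- u)) (≋-reflexive (≡.sym (-[a-b]≡b-a u v)))))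
                                 (≋±-negˡ p)
    split : val y ℤ.- val z ≋± + toℕ h → ∃₂ (Decomposition (h , i , j))
    split (inj₁ y-z≋h)  = fromℤ (val x ℤ.- val z) , fromℤ (val y ℤ.- val x) ,
      ≋±-trans (inj₁ (val-fromℤ (val x ℤ.- val z))) x-z≋±i , negated (val x) (val y) x-y≋±j ,
      ≋-trans (+-cong-≋ (val-fromℤ (val x ℤ.- val z)) (val-fromℤ (val y ℤ.- val x)))
              (≋-trans (≋-reflexive ([a-c]+[b-a]≡b-c (val x) (val y) (val z))) y-z≋h)
    split (inj₂ y-z≋-h) = fromℤ (val z ℤ.- val x) , fromℤ (val x ℤ.- val y) ,
      negated (val x) (val z) x-z≋±i , ≋±-trans (inj₁ (val-fromℤ (val x ℤ.- val y))) x-y≋±j ,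
      ≋-trans (+-cong-≋ (val-fromℤ (val z ℤ.- val x)) (val-fromℤ (val x ℤ.- val y)))
              (≋-trans (≋-reflexive ([c-a]+[a-b]≡-[b-c] (val x) (val y) (val z))) (≋-neg-neg y-z≋-h))

  count≢0⇒decomposition : ∀ t → count t ≢ 0 → ∃₂ (Decomposition t)
  count≢0⇒decomposition t count≢0 =
    let a , row≢0   = sumℕ≢0⇒ (λ a → sumℕ (λ b → 𝟙ℕ (decomposition? t a b))) count≢0
        b , entry≢0 = sumℕ≢0⇒ (λ b → 𝟙ℕ (decomposition? t a b)) row≢0
    in a , b , 𝟙ℕ≢0⇒ (decomposition? t a b) entry≢0

  decomposition⇒count≢0 : ∀ t a b → Decomposition t a b → count t ≢ 0
  decomposition⇒count≢0 t a b d = ⇒sumℕ≢0 (λ a → sumℕ (λ b → 𝟙ℕ (decomposition? t a b))) a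
    (⇒sumℕ≢0 (λ b → 𝟙ℕ (decomposition? t a b)) b (⇒𝟙ℕ≢0 (decomposition? t a b) d))

  profileᵢ : Fin N → Fin N → Fin N → Fin (suc D) × Fin (suc D) × Fin (suc D)
  profileᵢ x y z = distᵢ y z , distᵢ x z , distᵢ x y
    where
    distᵢ : Fin N → Fin N → Fin (suc D)
    distᵢ a b = fromℕ< (s≤s (dist≤D a b))

  toℕ³-profileᵢ : ∀ x y z → toℕ³ (profileᵢ x y z) ≡ profile x y z
  toℕ³-profileᵢ x y z = ≡.cong₂ _,_ (Finₚ.toℕ-fromℕ< _) (≡.cong₂ _,_ (Finₚ.toℕ-fromℕ< _) (Finₚ.toℕ-fromℕ< _))

  profile-count≢0 : ∀ x y z → count (profileᵢ x y z) ≢ 0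
  profile-count≢0 x y z =
    let a , b , d = profile⇒decomposition x y z (profileᵢ x y z) (≡.sym (toℕ³-profileᵢ x y z))
    in decomposition⇒count≢0 (profileᵢ x y z) a b d

-- Primitive idempotents and Krein parameters of the cycle

module CycleSpectrum {c ℓ} (R : CommutativeRing c ℓ) (isField : IsField R)
                     (N D : ℕ) .{{_ : NonZero N}}
                     (2D≤N : D ℕ.+ D ℕ.≤ N) (N≤2D+1 : N ℕ.≤ suc (D ℕ.+ D)) (3≤N : 3 ℕ.≤ N)
                     (ζ : CommutativeRing.Carrier R) (ζ-primitive : IsPrimitiveRoot R N ζ) where
  open CommutativeRing R
  open RingFacts R
  open FieldFacts R isField
  open Modular N
  open Bounded D 2D≤N N≤2D+1
  open Characters R isField N ζ ζ-primitive
  open Cycle R N D ζ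
  open CycleGraph N D 2D≤N N≤2D+1 3≤N
  module *-CS = CommutativeSemigroupProperties *-commutativeSemigroup
  open SetoidReasoning setoid

  ⟨_,_⟩ : Vect → Vect → Carrier
  ⟨ u , v ⟩ = sum (λ x → u x * v x)

  ⟨⟩-scaleˡ : ∀ α u v → ⟨ (λ x → α * u x) , v ⟩ ≈ α * ⟨ u , v ⟩
  ⟨⟩-scaleˡ α u v = trans (sum-cong-≋ (λ x → *-assoc α (u x) (v x)))
                          (sym (*-distribˡ-sum α (λ x → u x * v x)))

  ⟨⟩-scaleʳ : ∀ α u v → ⟨ u , (λ x → α * v x) ⟩ ≈ α * ⟨ u , v ⟩
  ⟨⟩-scaleʳ α u v = trans (sum-cong-≋ (λ x → *-CS.x∙yz≈y∙xz (u x) α (v x)))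
                          (sym (*-distribˡ-sum α (λ x → u x * v x)))

  ·V≡sum : ∀ M v x → (M ·V v) x ≡ sum (λ y → M x y * v y)
  ·V≡sum M v x = sumF≡sum (λ y → M x y * v y)

  IsSymmetric : Mat → Set ℓ
  IsSymmetric M = ∀ x y → M x y ≈ M y x

  symmetric⇒self-adjoint : ∀ {M} → IsSymmetric M → ∀ u v → ⟨ M ·V u , v ⟩ ≈ ⟨ u , M ·V v ⟩
  symmetric⇒self-adjoint {M} M-sym u v = begin
    ⟨ M ·V u , v ⟩                                     ≈⟨ sum-cong-≋ (λ x → *-congʳ (reflexive (·V≡sum M u x))) ⟩
    sum (λ x → sum (λ y → M x y * u y) * v x)           ≈⟨ sum-cong-≋ (λ x → *-distribʳ-sum (v x) (λ y → M x y * u y)) ⟩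
    sum (λ x → sum (λ y → M x y * u y * v x))           ≈⟨ ∑-comm (λ x y → M x y * u y * v x) ⟩
    sum (λ y → sum (λ x → M x y * u y * v x))           ≈⟨ sum-cong-≋ (λ y → sum-cong-≋ (λ x → rearrange x y)) ⟩
    sum (λ y → sum (λ x → u y * (M y x * v x)))         ≈⟨ sum-cong-≋ (λ y → *-distribˡ-sum (u y) (λ x → M y x * v x)) ⟨
    sum (λ y → u y * sum (λ x → M y x * v x))           ≈⟨ sum-cong-≋ (λ y → *-congˡ (reflexive (·V≡sum M v y))) ⟨
    ⟨ u , M ·V v ⟩                                     ∎
    where
    rearrange : ∀ x y → M x y * u y * v x ≈ u y * (M y x * v x)
    rearrange x y = trans (*-congʳ (*-comm (M x y) (u y)))
                          (trans (*-assoc (u y) (M x y) (v x)) (*-congˡ (*-congʳ (M-sym x y))))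

  eigenvectors-orthogonal : ∀ {M u v α β} → IsSymmetric M →
    (M ·V u) ≈V (λ x → α * u x) → (M ·V v) ≈V (λ x → β * v x) → ¬ α ≈ β → ⟨ u , v ⟩ ≈ 0#
  eigenvectors-orthogonal {M} {u} {v} {α} {β} M-sym Mu≈αu Mv≈βv α≉β =
    distinct-eigenvalues α≉β (begin
      α * ⟨ u , v ⟩                  ≈⟨ ⟨⟩-scaleˡ α u v ⟨
      ⟨ (λ x → α * u x) , v ⟩        ≈⟨ sum-cong-≋ (λ x → *-congʳ (Mu≈αu x)) ⟨
      ⟨ M ·V u , v ⟩                 ≈⟨ symmetric⇒self-adjoint M-sym u v ⟩
      ⟨ u , M ·V v ⟩                 ≈⟨ sum-cong-≋ (λ x → *-congˡ (Mv≈βv x)) ⟩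
      ⟨ u , (λ x → β * v x) ⟩        ≈⟨ ⟨⟩-scaleʳ β u v ⟩
      β * ⟨ u , v ⟩                  ∎)

  A₁≡𝟙 : ∀ x y → A₁ x y ≡ 𝟙 (dist x y ℕ.≟ 1)
  A₁≡𝟙 x y with dist x y ℕ.≟ 1
  ... | yes _ = ≡.refl
  ... | no _  = ≡.refl

  A₁-symmetric : IsSymmetric A₁
  A₁-symmetric x y = reflexive (≡.cong (λ d → if ⌊ d ℕ.≟ 1 ⌋ then 1# else 0#) (dist-sym x y))

  A₁≈𝟙+𝟙 : ∀ x y → A₁ x y ≈ 𝟙 (y Fin.≟ next x) + 𝟙 (y Fin.≟ prev x)
  A₁≈𝟙+𝟙 x y with y Fin.≟ next x | y Fin.≟ prev x
  ... | yes ≡.refl | yes next≡prev = ⊥-elim (next≢prev x next≡prev)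
  ... | yes ≡.refl | no _          =
    trans (reflexive (A₁≡𝟙 x y)) (trans (𝟙-yes (dist x y ℕ.≟ 1) (dist-next x)) (sym (+-identityʳ 1#)))
  ... | no _       | yes ≡.refl    =
    trans (reflexive (A₁≡𝟙 x y)) (trans (𝟙-yes (dist x y ℕ.≟ 1) (dist-prev x)) (sym (+-identityˡ 1#)))
  ... | no y≢next  | no y≢prev     =
    trans (reflexive (A₁≡𝟙 x y)) (trans (𝟙-no (dist x y ℕ.≟ 1) nonadjacent) (sym (+-identityˡ 0#)))
    where
    nonadjacent : dist x y ≢ 1
    nonadjacent = [ y≢next , y≢prev ]′ ∘ adjacent⇒next⊎prev x y

  A₁-apply : ∀ v x → (A₁ ·V v) x ≈ v (next x) + v (prev x)
  A₁-apply v x = begin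
    (A₁ ·V v) x                                              ≡⟨ ·V≡sum A₁ v x ⟩
    sum (λ y → A₁ x y * v y)                                 ≈⟨ sum-cong-≋ (λ y → trans (*-congʳ (A₁≈𝟙+𝟙 x y)) (distribʳ (v y) _ _)) ⟩
    sum (λ y → 𝟙 (y Fin.≟ next x) * v y + 𝟙 (y Fin.≟ prev x) * v y)
                                                             ≈⟨ ∑-distrib-+ (λ y → 𝟙 (y Fin.≟ next x) * v y) (λ y → 𝟙 (y Fin.≟ prev x) * v y) ⟩
    sum (λ y → 𝟙 (y Fin.≟ next x) * v y) + sum (λ y → 𝟙 (y Fin.≟ prev x) * v y)
                                                             ≈⟨ +-cong (sum-select v (next x)) (sum-select v (prev x)) ⟩
    v (next x) + v (prev x)                                  ∎

  ψ : ℤ → Vect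
  ψ m x = e (m ℤ.* val x)

  A₁-ψ : ∀ m → (A₁ ·V ψ m) ≈V (λ x → Θ m * ψ m x)
  A₁-ψ m x = begin
    (A₁ ·V ψ m) x                                        ≈⟨ A₁-apply (ψ m) x ⟩
    e (m ℤ.* val (next x)) + e (m ℤ.* val (prev x))      ≈⟨ +-cong (e-cong (*-congˡ-≋ m (val-fromℤ (val x ℤ.+ 1ℤ))))
                                                                   (e-cong (*-congˡ-≋ m (val-fromℤ (val x ℤ.- 1ℤ)))) ⟩
    e (m ℤ.* (val x ℤ.+ 1ℤ)) + e (m ℤ.* (val x ℤ.- 1ℤ))  ≡⟨ ≡.cong₂ (λ a b → e a + e b) (c[a+1]≡c+ca m (val x)) (c[a-1]≡-c+ca m (val x)) ⟩
    e (m ℤ.+ m ℤ.* val x) + e (ℤ.- m ℤ.+ m ℤ.* val x)    ≈⟨ +-cong (e-homo m (m ℤ.* val x)) (e-homo (ℤ.- m) (m ℤ.* val x)) ⟩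
    e m * ψ m x + e (ℤ.- m) * ψ m x                      ≈⟨ distribʳ (ψ m x) (e m) (e (ℤ.- m)) ⟨
    Θ m * ψ m x                                          ∎
    where
    c[a+1]≡c+ca : ∀ c a → c ℤ.* (a ℤ.+ 1ℤ) ≡ c ℤ.+ c ℤ.* a
    c[a+1]≡c+ca = solve-∀
    c[a-1]≡-c+ca : ∀ c a → c ℤ.* (a ℤ.- 1ℤ) ≡ ℤ.- c ℤ.+ c ℤ.* a
    c[a-1]≡-c+ca = solve-∀

  θ≈Θ : ∀ {i} → i ℕ.≤ D → θ i ≈ Θ (+ i)
  θ≈Θ i≤D = pow+pow≈Θ (ℕₚ.<⇒≤ (≤D⇒<N i≤D))

  θ-injective : ∀ {i j} → i ℕ.≤ D → j ℕ.≤ D → θ i ≈ θ j → i ≡ j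
  θ-injective {i} {j} i≤D j≤D θi≈θj =
    ≋±-injective i≤D j≤D (Θ-injective (+ i) (+ j) (trans (sym (θ≈Θ i≤D)) (trans θi≈θj (θ≈Θ j≤D))))

  ψ-homo : ∀ a b x → ψ a x * ψ b x ≈ ψ (a ℤ.+ b) x
  ψ-homo a b x = trans (sym (e-homo (a ℤ.* val x) (b ℤ.* val x)))
                       (reflexive (≡.cong e (≡.sym (ℤₚ.*-distribʳ-+ (val x) a b))))

  ψ-sum-origin : sum (λ m → ψ (val m) origin) ≈ natR R N
  ψ-sum-origin = trans (sum-cong-≋ (λ m → e-cong (≋-reflexive (ℤₚ.*-comm (val m) (val origin)))))
                       (character-sum-≋0 (val origin) (val-fromℤ 0ℤ))

  ψ-sum-≢origin : ∀ {x} → x ≢ origin → sum (λ m → ψ (val m) x) ≈ 0#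
  ψ-sum-≢origin {x} x≢o = trans (sum-cong-≋ (λ m → e-cong (≋-reflexive (ℤₚ.*-comm (val m) (val x)))))
                                (character-sum-≉0 (val x) (x≢o ∘ fromℤ-≋-origin))
    where
    fromℤ-≋-origin : val x ≋ 0ℤ → x ≡ origin
    fromℤ-≋-origin x≋0 = val-injective (≋-trans x≋0 (≋-sym (val-fromℤ 0ℤ)))

  -- N times the Fourier coefficient of g at t.
  coefficient : ℤ → Vect → Carrier
  coefficient t g = sum (λ x → ψ (ℤ.- t) x * g x)

  coefficient-cong : ∀ t {g g'} → g ≈V g' → coefficient t g ≈ coefficient t g'
  coefficient-cong t g≈g' = sum-cong-≋ (λ x → *-congˡ (g≈g' x))

  coefficient-scale : ∀ t c g → coefficient t (λ x → c * g x) ≈ c * coefficient t g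
  coefficient-scale t c g = trans (sum-cong-≋ (λ x → *-CS.x∙yz≈y∙xz (ψ (ℤ.- t) x) c (g x)))
                                  (sym (*-distribˡ-sum c (λ x → ψ (ℤ.- t) x * g x)))

  coefficient-sum : ∀ {n} t (g : Fin n → Vect) →
    coefficient t (λ x → sum (λ m → g m x)) ≈ sum (λ m → coefficient t (g m))
  coefficient-sum t g = trans (sum-cong-≋ (λ x → *-distribˡ-sum (ψ (ℤ.- t) x) (λ m → g m x)))
                              (∑-comm (λ x m → ψ (ℤ.- t) x * g m x))

  coefficient-ψ : ∀ t m → coefficient t (ψ m) ≈ 𝟙 (≋-dec m t) * natR R N
  coefficient-ψ t m = trans (sum-cong-≋ ψ-tψm) (orthogonality (≋-dec m t))
    where
    ψ-tψm : ∀ x → ψ (ℤ.- t) x * ψ m x ≈ e ((m ℤ.- t) ℤ.* val x)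
    ψ-tψm x = trans (ψ-homo (ℤ.- t) m x) (reflexive (≡.cong (λ a → e (a ℤ.* val x)) (ℤₚ.+-comm (ℤ.- t) m)))
    orthogonality : (d : Dec (m ≋ t)) → sum (λ x → e ((m ℤ.- t) ℤ.* val x)) ≈ 𝟙 d * natR R N
    orthogonality (yes m≋t) = trans (character-sum-≋0 (m ℤ.- t) (≋⇒≋0 m≋t)) (sym (*-identityˡ (natR R N)))
    orthogonality (no m≉t)  = trans (character-sum-≉0 (m ℤ.- t) (m≉t ∘ ≋0⇒≋)) (sym (zeroˡ (natR R N)))

  coefficient-expansion : ∀ t (c : Fin N → Carrier) →
    coefficient t (λ x → sum (λ m → c m * ψ (val m) x)) ≈ c (fromℤ t) * natR R N
  coefficient-expansion t c = begin
    coefficient t (λ x → sum (λ m → c m * ψ (val m) x))   ≈⟨ coefficient-sum t (λ m x → c m * ψ (val m) x) ⟩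
    sum (λ m → coefficient t (λ x → c m * ψ (val m) x))   ≈⟨ sum-cong-≋ (λ m → coefficient-scale t (c m) (ψ (val m))) ⟩
    sum (λ m → c m * coefficient t (ψ (val m)))           ≈⟨ sum-δ _ (fromℤ t) (λ m m≢t → trans (*-congˡ (other m m≢t)) (zeroʳ (c m))) ⟩
    c (fromℤ t) * coefficient t (ψ (val (fromℤ t)))       ≈⟨ *-congˡ (coefficient-ψ t (val (fromℤ t))) ⟩
    c (fromℤ t) * (𝟙 (≋-dec (val (fromℤ t)) t) * natR R N)  ≈⟨ *-congˡ (trans (*-congʳ (𝟙-yes (≋-dec _ t) (val-fromℤ t))) (*-identityˡ _)) ⟩
    c (fromℤ t) * natR R N                                ∎
    where
    other : ∀ m → m ≢ fromℤ t → coefficient t (ψ (val m)) ≈ 0#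
    other m m≢t = trans (coefficient-ψ t (val m))
                        (trans (*-congʳ (𝟙-no (≋-dec (val m) t) (λ m≋t → m≢t (≡.sym (fromℤ-≋ (≋-sym m≋t))))))
                               (zeroˡ (natR R N)))

  χ : Idx → ℤ → Carrier
  χ k a = 𝟙 (≋±-dec a (+ toℕ k))

  χ-cong : ∀ k {a b} → a ≋ b → χ k a ≈ χ k b
  χ-cong k {a} {b} a≋b with ≋±-dec a (+ toℕ k) | ≋±-dec b (+ toℕ k)
  ... | yes _    | yes _    = refl
  ... | no  _    | no  _    = refl
  ... | yes a≋±k | no  b≉±k = ⊥-elim (b≉±k (≋±-trans (inj₁ (≋-sym a≋b)) a≋±k))
  ... | no  a≉±k | yes b≋±k = ⊥-elim (a≉±k (≋±-trans (inj₁ a≋b) b≋±k))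

  χ-at : ∀ k h → χ k (+ toℕ h) ≈ 𝟙 (k Fin.≟ h)
  χ-at k h with ≋±-dec (+ toℕ h) (+ toℕ k) | k Fin.≟ h
  ... | yes _    | yes _   = refl
  ... | no  _    | no  _   = refl
  ... | yes h≋±k | no  k≢h = ⊥-elim (k≢h (Finₚ.toℕ-injective (≋±-injective (idx≤D k) (idx≤D h) (≋±-sym h≋±k))))
  ... | no  h≉±k | yes ≡.refl = ⊥-elim (h≉±k ≋±-refl)

  expansion-product : ∀ (c d : Fin N → Carrier) x →
    sum (λ a → c a * ψ (val a) x) * sum (λ b → d b * ψ (val b) x) ≈
    sum (λ a → sum (λ b → (c a * d b) * ψ (val a ℤ.+ val b) x))
  expansion-product c d x = begin
    sum (λ a → c a * ψ (val a) x) * sum (λ b → d b * ψ (val b) x)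
      ≈⟨ *-distribʳ-sum (sum (λ b → d b * ψ (val b) x)) (λ a → c a * ψ (val a) x) ⟩
    sum (λ a → (c a * ψ (val a) x) * sum (λ b → d b * ψ (val b) x))
      ≈⟨ sum-cong-≋ (λ a → *-distribˡ-sum (c a * ψ (val a) x) (λ b → d b * ψ (val b) x)) ⟩
    sum (λ a → sum (λ b → (c a * ψ (val a) x) * (d b * ψ (val b) x)))
      ≈⟨ sum-cong-≋ (λ a → sum-cong-≋ (λ b → trans (*-CS.interchange (c a) (ψ (val a) x) (d b) (ψ (val b) x)) (*-congˡ (ψ-homo (val a) (val b) x)))) ⟩
    sum (λ a → sum (λ b → (c a * d b) * ψ (val a ℤ.+ val b) x))   ∎

  natR-count : ∀ t → natR R (count t) ≈ sum (λ a → sum (λ b → natR R (𝟙ℕ (decomposition? t a b))))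
  natR-count t = trans (natR-sumℕ (λ a → sumℕ (λ b → 𝟙ℕ (decomposition? t a b))))
                       (sum-cong-≋ (λ a → natR-sumℕ (λ b → 𝟙ℕ (decomposition? t a b))))

  coefficient-pair : ∀ h i j a b →
    coefficient (+ toℕ h) (λ x → (χ i (val a) * χ j (val b)) * ψ (val a ℤ.+ val b) x) ≈
    natR R (𝟙ℕ (decomposition? (h , i , j) a b)) * natR R N
  coefficient-pair h i j a b = begin
    coefficient H (λ x → w * ψ (val a ℤ.+ val b) x)                ≈⟨ coefficient-scale H w (ψ (val a ℤ.+ val b)) ⟩
    w * coefficient H (ψ (val a ℤ.+ val b))                        ≈⟨ *-congˡ (coefficient-ψ H (val a ℤ.+ val b)) ⟩
    w * (𝟙 (≋-dec (val a ℤ.+ val b) H) * natR R N)                 ≈⟨ *-assoc w _ _ ⟨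
    (w * 𝟙 (≋-dec (val a ℤ.+ val b) H)) * natR R N                 ≈⟨ *-congʳ (*-assoc (χ i (val a)) _ _) ⟩
    (χ i (val a) * (χ j (val b) * 𝟙 (≋-dec (val a ℤ.+ val b) H))) * natR R N
      ≈⟨ *-congʳ (trans (*-congˡ (sym (𝟙-×-dec (≋±-dec (val b) (+ toℕ j)) (≋-dec (val a ℤ.+ val b) H))))
                        (sym (𝟙-×-dec (≋±-dec (val a) (+ toℕ i)) _))) ⟩
    𝟙 (decomposition? (h , i , j) a b) * natR R N                  ≈⟨ *-congʳ (natR-𝟙ℕ (decomposition? (h , i , j) a b)) ⟨
    natR R (𝟙ℕ (decomposition? (h , i , j) a b)) * natR R N        ∎
    where
    H : ℤ
    H = + toℕ h
    w : Carrier
    w = χ i (val a) * χ j (val b)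

  module Projections (E : Idx → Mat) (E-proj : ∀ k → IsEigenProj k (E k)) where

    E-symmetric : ∀ k → IsSymmetric (E k)
    E-symmetric k = proj₁ (proj₂ (E-proj k))

    fixed⇔eigen : ∀ k v → (E k ·V v) ≈V v ⇔ (A₁ ·V v) ≈V (λ x → θ (toℕ k) * v x)
    fixed⇔eigen k = proj₂ (proj₂ (E-proj k))

    -- Columns of an idempotent are fixed by it.
    column-eigen : ∀ k y → (A₁ ·V (λ x → E k x y)) ≈V (λ x → θ (toℕ k) * E k x y)
    column-eigen k y = Equivalence.to (fixed⇔eigen k (λ x → E k x y)) (λ x → proj₁ (E-proj k) x y)

    E-ψ-fixed : ∀ k m → m ≋± + toℕ k → (E k ·V ψ m) ≈V ψ m
    E-ψ-fixed k m m≋±k = Equivalence.from (fixed⇔eigen k (ψ m))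
      (λ x → trans (A₁-ψ m x) (*-congʳ (trans (Θ-cong m≋±k) (sym (θ≈Θ (idx≤D k))))))

    E-ψ-killed : ∀ k m → ¬ m ≋± + toℕ k → ∀ y → (E k ·V ψ m) y ≈ 0#
    E-ψ-killed k m m≉±k y = begin
      (E k ·V ψ m) y                   ≡⟨ ·V≡sum (E k) (ψ m) y ⟩
      sum (λ x → E k y x * ψ m x)      ≈⟨ sum-cong-≋ (λ x → *-congʳ (E-symmetric k y x)) ⟩
      ⟨ (λ x → E k x y) , ψ m ⟩        ≈⟨ eigenvectors-orthogonal A₁-symmetric (column-eigen k y) (A₁-ψ m) θk≉Θm ⟩
      0#                               ∎
      where
      θk≉Θm : ¬ θ (toℕ k) ≈ Θ m
      θk≉Θm θk≈Θm = m≉±k (≋±-sym (Θ-injective (+ toℕ k) m (trans (sym (θ≈Θ (idx≤D k))) θk≈Θm)))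

    E-ψ : ∀ k m → (E k ·V ψ m) ≈V (λ x → χ k m * ψ m x)
    E-ψ k m x with ≋±-dec m (+ toℕ k)
    ... | yes m≋±k = trans (E-ψ-fixed k m m≋±k x) (sym (*-identityˡ (ψ m x)))
    ... | no  m≉±k = trans (E-ψ-killed k m m≉±k x) (sym (zeroˡ (ψ m x)))

    F : Idx → Vect
    F k x = natR R N * E k x origin

    F-expansion : ∀ k x → F k x ≈ sum (λ m → χ k (val m) * ψ (val m) x)
    F-expansion k x = begin
      natR R N * E k x origin                              ≈⟨ *-comm _ _ ⟩
      E k x origin * natR R N                              ≈⟨ *-congˡ ψ-sum-origin ⟨
      E k x origin * Φ origin                              ≈⟨ sum-δ (λ x' → E k x x' * Φ x') origin
                                                                  (λ x' x'≢o → trans (*-congˡ (ψ-sum-≢origin x'≢o)) (zeroʳ _)) ⟨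
      sum (λ x' → E k x x' * Φ x')                         ≈⟨ sum-cong-≋ (λ x' → *-distribˡ-sum (E k x x') (λ m → ψ (val m) x')) ⟩
      sum (λ x' → sum (λ m → E k x x' * ψ (val m) x'))     ≈⟨ ∑-comm (λ x' m → E k x x' * ψ (val m) x') ⟩
      sum (λ m → sum (λ x' → E k x x' * ψ (val m) x'))     ≈⟨ sum-cong-≋ (λ m → trans (reflexive (≡.sym (·V≡sum (E k) (ψ (val m)) x)))
                                                                                      (E-ψ k (val m) x)) ⟩
      sum (λ m → χ k (val m) * ψ (val m) x)                ∎
      where
      Φ : Fin N → Carrier
      Φ x' = sum (λ m → ψ (val m) x')

    module Krein (q : Idx → Idx → Idx → Carrier) (krein : KreinEq E q) (charZero : CharZero R) where

      F-product : ∀ i j x → F i x * F j x ≈ sum (λ h → q h i j * F h x)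
      F-product i j x = begin
        (n * E i x origin) * (n * E j x origin)     ≈⟨ *-CS.interchange n (E i x origin) n (E j x origin) ⟩
        (n * n) * (E i x origin * E j x origin)     ≈⟨ *-assoc n n _ ⟩
        n * (n * (E i x origin * E j x origin))     ≈⟨ *-congˡ (krein i j x origin) ⟩
        n * sumF R (λ h → q h i j * E h x origin)   ≡⟨ ≡.cong (n *_) (sumF≡sum (λ h → q h i j * E h x origin)) ⟩
        n * sum (λ h → q h i j * E h x origin)      ≈⟨ *-distribˡ-sum n (λ h → q h i j * E h x origin) ⟩
        sum (λ h → n * (q h i j * E h x origin))    ≈⟨ sum-cong-≋ (λ h → *-CS.x∙yz≈y∙xz n (q h i j) (E h x origin)) ⟩
        sum (λ h → q h i j * F h x)                 ∎
        where
        n : Carrier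
        n = natR R N

      coefficient-F : ∀ h k → coefficient (+ toℕ h) (F k) ≈ 𝟙 (k Fin.≟ h) * natR R N
      coefficient-F h k = begin
        coefficient H (F k)                                           ≈⟨ coefficient-cong H (F-expansion k) ⟩
        coefficient H (λ x → sum (λ m → χ k (val m) * ψ (val m) x))  ≈⟨ coefficient-expansion H (χ k ∘ val) ⟩
        χ k (val (fromℤ H)) * natR R N                                ≈⟨ *-congʳ (trans (χ-cong k (val-fromℤ H)) (χ-at k h)) ⟩
        𝟙 (k Fin.≟ h) * natR R N                                      ∎
        where
        H : ℤ
        H = + toℕ h

      coefficient-FF : ∀ h i j → coefficient (+ toℕ h) (λ x → F i x * F j x) ≈ natR R (count (h , i , j)) * natR R N
      coefficient-FF h i j = begin
        coefficient H (λ x → F i x * F j x)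
          ≈⟨ coefficient-cong H (λ x → trans (*-cong (F-expansion i x) (F-expansion j x))
                                              (expansion-product (χ i ∘ val) (χ j ∘ val) x)) ⟩
        coefficient H (λ x → sum (λ a → sum (λ b → w a b * ψ (val a ℤ.+ val b) x)))
          ≈⟨ coefficient-sum H (λ a x → sum (λ b → w a b * ψ (val a ℤ.+ val b) x)) ⟩
        sum (λ a → coefficient H (λ x → sum (λ b → w a b * ψ (val a ℤ.+ val b) x)))
          ≈⟨ sum-cong-≋ (λ a → coefficient-sum H (λ b x → w a b * ψ (val a ℤ.+ val b) x)) ⟩
        sum (λ a → sum (λ b → coefficient H (λ x → w a b * ψ (val a ℤ.+ val b) x)))
          ≈⟨ sum-cong-≋ (λ a → sum-cong-≋ (λ b → coefficient-pair h i j a b)) ⟩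
        sum (λ a → sum (λ b → natR R (𝟙ℕ (decomposition? t a b)) * natR R N))
          ≈⟨ sum-cong-≋ (λ a → *-distribʳ-sum (natR R N) (λ b → natR R (𝟙ℕ (decomposition? t a b)))) ⟨
        sum (λ a → sum (λ b → natR R (𝟙ℕ (decomposition? t a b))) * natR R N)
          ≈⟨ *-distribʳ-sum (natR R N) (λ a → sum (λ b → natR R (𝟙ℕ (decomposition? t a b)))) ⟨
        sum (λ a → sum (λ b → natR R (𝟙ℕ (decomposition? t a b)))) * natR R N
          ≈⟨ *-congʳ (natR-count t) ⟨
        natR R (count t) * natR R N
          ∎
        where
        H : ℤ
        H = + toℕ h
        t : Triple
        t = (h , i , j)
        w : Fin N → Fin N → Carrier
        w a b = χ i (val a) * χ j (val b)

      N≉0 : ¬ natR R N ≈ 0#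
      N≉0 N≈0 = ℕ.≢-nonZero⁻¹ N (charZero N N≈0)

      -- Compare the Fourier coefficients at h of both sides of the Krein equation.
      krein-count : ∀ h i j → q h i j ≈ natR R (count (h , i , j))
      krein-count h i j = *-cancelˡ-≉0 N≉0 (begin
        natR R N * q h i j                                      ≈⟨ *-comm _ _ ⟩
        q h i j * natR R N                                      ≈⟨ *-congˡ (trans (*-congʳ (𝟙-yes (h Fin.≟ h) ≡.refl)) (*-identityˡ _)) ⟨
        q h i j * (𝟙 (h Fin.≟ h) * natR R N)                    ≈⟨ sum-δ (λ h' → q h' i j * (𝟙 (h' Fin.≟ h) * natR R N)) h
                                                                     (λ h' h'≢h → trans (*-congˡ (trans (*-congʳ (𝟙-no (h' Fin.≟ h) h'≢h)) (zeroˡ _))) (zeroʳ _)) ⟨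
        sum (λ h' → q h' i j * (𝟙 (h' Fin.≟ h) * natR R N))     ≈⟨ sum-cong-≋ (λ h' → *-congˡ {x = q h' i j} (coefficient-F h h')) ⟨
        sum (λ h' → q h' i j * coefficient H (F h'))            ≈⟨ sum-cong-≋ (λ h' → coefficient-scale H (q h' i j) (F h')) ⟨
        sum (λ h' → coefficient H (λ x → q h' i j * F h' x))    ≈⟨ coefficient-sum H (λ h' x → q h' i j * F h' x) ⟨
        coefficient H (λ x → sum (λ h' → q h' i j * F h' x))    ≈⟨ coefficient-cong H (λ x → F-product i j x) ⟨
        coefficient H (λ x → F i x * F j x)                     ≈⟨ coefficient-FF h i j ⟩
        natR R (count (h , i , j)) * natR R N                   ≈⟨ *-comm _ _ ⟩
        natR R N * natR R (count (h , i , j))                   ∎)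
        where
        H : ℤ
        H = + toℕ h

      nonzero-count : ∀ {d} → Enumerates (λ t → count t ≢ 0) d → NonzeroCount q d
      nonzero-count (f , f-ok , f-inj , f-onto) = f , q≉0 , f-inj , onto
        where
        q≉0 : ∀ k → let (h , i , j) = f k in ¬ q h i j ≈ 0#
        q≉0 k q≈0 = f-ok k (charZero _ (trans (sym (krein-count _ _ _)) q≈0))
        onto : ∀ h i j → ¬ q h i j ≈ 0# → ∃ λ k → f k ≡ (h , i , j)
        onto h i j q≉0 = f-onto (h , i , j) (λ count≡0 → q≉0 (trans (krein-count h i j) (reflexive (≡.cong (natR R) count≡0))))

-- The fundamental module

module FundamentalModule {c ℓ} (R : CommutativeRing c ℓ) (isField : IsField R)
                         (N D : ℕ) .{{_ : NonZero N}}
                         (2D≤N : D ℕ.+ D ℕ.≤ N) (N≤2D+1 : N ℕ.≤ suc (D ℕ.+ D)) (3≤N : 3 ℕ.≤ N)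
                         (ζ : CommutativeRing.Carrier R) (ζ-primitive : IsPrimitiveRoot R N ζ) where
  open CommutativeRing R
  open RingFacts R
  open FieldFacts R isField
  open Modular N
  open Bounded D 2D≤N N≤2D+1
  open Cycle R N D ζ
  open CycleGraph N D 2D≤N N≤2D+1 3≤N
  open CycleSpectrum R isField N D 2D≤N N≤2D+1 3≤N ζ ζ-primitive using (θ-injective)
  open RingProperties ring using (x∙y⁻¹≈ε⇒x≈y)
  open SetoidReasoning setoid

  apply : Isometry → Fin N → Fin N
  apply σ = Isometry.π σ ⟨$⟩ʳ_

  Invariant : Tensor → Set ℓ
  Invariant t = ∀ σ x y z → t (apply σ x) (apply σ y) (apply σ z) ≈ t x y z

  A₁-invariant : ∀ σ a b → A₁ (apply σ a) (apply σ b) ≡ A₁ a b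
  A₁-invariant σ a b =
    ≡.cong (λ d → if ⌊ d ℕ.≟ 1 ⌋ then 1# else 0#) (Isometry.preserves-dist σ a b)

  A₁-sum-invariant : ∀ σ p (g g' : Fin N → Carrier) → (∀ w → g (apply σ w) ≈ g' w) →
    sumF R (λ w → A₁ (apply σ p) w * g w) ≈ sumF R (λ w → A₁ p w * g' w)
  A₁-sum-invariant σ p g g' g∘σ≈g' = begin
    sumF R (λ w → A₁ (apply σ p) w * g w)                    ≡⟨ sumF≡sum (λ w → A₁ (apply σ p) w * g w) ⟩
    sum (λ w → A₁ (apply σ p) w * g w)                       ≈⟨ sum-permute (λ w → A₁ (apply σ p) w * g w) (Isometry.π σ) ⟩
    sum (λ w → A₁ (apply σ p) (apply σ w) * g (apply σ w))   ≈⟨ sum-cong-≋ (λ w → *-cong (reflexive (A₁-invariant σ p w)) (g∘σ≈g' w)) ⟩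
    sum (λ w → A₁ p w * g' w)                                ≡⟨ sumF≡sum (λ w → A₁ p w * g' w) ⟨
    sumF R (λ w → A₁ p w * g' w)                             ∎

  θ-invariant : ∀ σ a b → θ (dist (apply σ a) (apply σ b)) ≡ θ (dist a b)
  θ-invariant σ a b = ≡.cong θ (Isometry.preserves-dist σ a b)

  InΛ⇒invariant : ∀ {t} → InΛ t → Invariant t
  InΛ⇒invariant one         σ x y z = refl
  InΛ⇒invariant zer         σ x y z = refl
  InΛ⇒invariant (add u v)   σ x y z = +-cong (InΛ⇒invariant u σ x y z) (InΛ⇒invariant v σ x y z)
  InΛ⇒invariant (scale a u) σ x y z = *-congˡ (InΛ⇒invariant u σ x y z)
  InΛ⇒invariant (resp u≈v u) σ x y z =
    trans (sym (u≈v _ _ _)) (trans (InΛ⇒invariant u σ x y z) (u≈v x y z))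
  InΛ⇒invariant (a1 u) σ x y z = A₁-sum-invariant σ x _ _ (λ w → InΛ⇒invariant u σ w y z)
  InΛ⇒invariant (a2 u) σ x y z = A₁-sum-invariant σ y _ _ (λ w → InΛ⇒invariant u σ x w z)
  InΛ⇒invariant (a3 u) σ x y z = A₁-sum-invariant σ z _ _ (λ w → InΛ⇒invariant u σ x y w)
  InΛ⇒invariant (a*1 u) σ x y z = *-cong (reflexive (θ-invariant σ y z)) (InΛ⇒invariant u σ x y z)
  InΛ⇒invariant (a*2 u) σ x y z = *-cong (reflexive (θ-invariant σ x z)) (InΛ⇒invariant u σ x y z)
  InΛ⇒invariant (a*3 u) σ x y z = *-cong (reflexive (θ-invariant σ x y)) (InΛ⇒invariant u σ x y z)

  invariant-transport : ∀ {t} → Invariant t → ∀ {x y z x' y' z'} →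
    (Σ Isometry λ σ → apply σ x ≡ x' × apply σ y ≡ y' × apply σ z ≡ z') → t x y z ≈ t x' y' z'
  invariant-transport t-inv {x} {y} {z} (σ , ≡.refl , ≡.refl , ≡.refl) = sym (t-inv σ x y z)

  invariant⇒profile-determined : ∀ {t} → Invariant t → ∀ {x y z x' y' z'} →
    profile x y z ≡ profile x' y' z' → t x y z ≈ t x' y' z'
  invariant⇒profile-determined t-inv {x} {y} {z} {x'} {y'} {z'} eq = invariant-transport t-inv
    (triangle-congruence x y z x' y' z' (≡.cong proj₁ eq) (≡.cong (proj₁ ∘ proj₂) eq) (≡.cong (proj₂ ∘ proj₂) eq))

  module Selection (δ : Fin N → Fin N → Fin N → ℕ) (δ≤D : ∀ x y z → δ x y z ℕ.≤ D)
                   (diagonal-closed : ∀ {t} → InΛ t → InΛ (λ x y z → θ (δ x y z) * t x y z)) where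

    op : Tensor → Tensor
    op t x y z = θ (δ x y z) * t x y z

    lagrange : ℕ → ℕ → Tensor → Tensor
    lagrange j zero    t = t
    lagrange j (suc l) t with l ℕ.≟ j
    ... | yes _ = lagrange j l t
    ... | no  _ = λ x y z → op (lagrange j l t) x y z + - θ l * lagrange j l t x y z

    Π : ℕ → ℕ → ℕ → Carrier
    Π j zero    d = 1#
    Π j (suc l) d with l ℕ.≟ j
    ... | yes _ = Π j l d
    ... | no  _ = (θ d - θ l) * Π j l d

    lagrange-InΛ : ∀ j n {t} → InΛ t → InΛ (lagrange j n t)
    lagrange-InΛ j zero    t∈Λ = t∈Λ
    lagrange-InΛ j (suc l) t∈Λ with l ℕ.≟ j
    ... | yes _ = lagrange-InΛ j l t∈Λ
    ... | no  _ = add (diagonal-closed (lagrange-InΛ j l t∈Λ)) (scale (- θ l) (lagrange-InΛ j l t∈Λ))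

    lagrange-value : ∀ j n t x y z → lagrange j n t x y z ≈ Π j n (δ x y z) * t x y z
    lagrange-value j zero    t x y z = sym (*-identityˡ (t x y z))
    lagrange-value j (suc l) t x y z with l ℕ.≟ j
    ... | yes _ = lagrange-value j l t x y z
    ... | no  _ = begin
      θ (δ x y z) * s x y z + - θ l * s x y z   ≈⟨ distribʳ (s x y z) (θ (δ x y z)) (- θ l) ⟨
      (θ (δ x y z) - θ l) * s x y z             ≈⟨ *-congˡ (lagrange-value j l t x y z) ⟩
      (θ (δ x y z) - θ l) * (Π j l (δ x y z) * t x y z)  ≈⟨ *-assoc _ _ _ ⟨
      (θ (δ x y z) - θ l) * Π j l (δ x y z) * t x y z    ∎
      where
      s : Tensor
      s = lagrange j l t

    Π-vanishes : ∀ j n d → d ℕ.< n → d ≢ j → Π j n d ≈ 0#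
    Π-vanishes j (suc l) d d<1+l d≢j with l ℕ.≟ j | d ℕ.≟ l
    ... | yes l≡j | yes d≡l = ⊥-elim (d≢j (≡.trans d≡l l≡j))
    ... | yes _   | no  d≢l = Π-vanishes j l d (ℕₚ.≤∧≢⇒< (ℕₚ.≤-pred d<1+l) d≢l) d≢j
    ... | no  _   | yes ≡.refl = trans (*-congʳ (-‿inverseʳ (θ d))) (zeroˡ _)
    ... | no  _   | no  d≢l = trans (*-congˡ (Π-vanishes j l d (ℕₚ.≤∧≢⇒< (ℕₚ.≤-pred d<1+l) d≢l) d≢j)) (zeroʳ _)

    Π-nonzero : ∀ j n → j ℕ.≤ D → n ℕ.≤ suc D → ¬ Π j n j ≈ 0#
    Π-nonzero j zero    j≤D n≤1+D = 1≉0
    Π-nonzero j (suc l) j≤D n≤1+D with l ℕ.≟ j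
    ... | yes _   = Π-nonzero j l j≤D (ℕₚ.m+n≤o⇒n≤o 1 n≤1+D)
    ... | no  l≢j = *-≉0 θj-θl≉0 (Π-nonzero j l j≤D (ℕₚ.m+n≤o⇒n≤o 1 n≤1+D))
      where
      θj-θl≉0 : ¬ θ j - θ l ≈ 0#
      θj-θl≉0 = l≢j ∘ ≡.sym ∘ θ-injective j≤D (ℕₚ.≤-pred n≤1+D) ∘ x∙y⁻¹≈ε⇒x≈y (θ j) (θ l)

    select : ∀ j → j ℕ.≤ D → ∀ {t} → InΛ t → InΛ (λ x y z → 𝟙 (δ x y z ℕ.≟ j) * t x y z)
    select j j≤D {t} t∈Λ = resp selected (scale c⁻¹ (lagrange-InΛ j (suc D) t∈Λ))
      where
      inverse : ∃ λ c → Π j (suc D) j * c ≈ 1#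
      inverse = proj₂ isField (Π j (suc D) j) (Π-nonzero j (suc D) j≤D ℕₚ.≤-refl)
      c⁻¹ : Carrier
      c⁻¹ = proj₁ inverse
      Πc⁻¹≈1 : Π j (suc D) j * c⁻¹ ≈ 1#
      Πc⁻¹≈1 = proj₂ inverse
      selected : ∀ x y z → c⁻¹ * lagrange j (suc D) t x y z ≈ 𝟙 (δ x y z ℕ.≟ j) * t x y z
      selected x y z with δ x y z ℕ.≟ j
      ... | yes δ≡j = begin
        c⁻¹ * lagrange j (suc D) t x y z           ≈⟨ *-congˡ (lagrange-value j (suc D) t x y z) ⟩
        c⁻¹ * (Π j (suc D) (δ x y z) * t x y z)    ≡⟨ ≡.cong (λ d → c⁻¹ * (Π j (suc D) d * t x y z)) δ≡j ⟩
        c⁻¹ * (Π j (suc D) j * t x y z)            ≈⟨ *-assoc c⁻¹ _ _ ⟨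
        (c⁻¹ * Π j (suc D) j) * t x y z            ≈⟨ *-congʳ (trans (*-comm c⁻¹ _) Πc⁻¹≈1) ⟩
        1# * t x y z                               ∎
      ... | no δ≢j = begin
        c⁻¹ * lagrange j (suc D) t x y z           ≈⟨ *-congˡ (lagrange-value j (suc D) t x y z) ⟩
        c⁻¹ * (Π j (suc D) (δ x y z) * t x y z)    ≈⟨ *-congˡ (*-congʳ (Π-vanishes j (suc D) (δ x y z) (s≤s (δ≤D x y z)) δ≢j)) ⟩
        c⁻¹ * (0# * t x y z)                       ≈⟨ *-congˡ (zeroˡ (t x y z)) ⟩
        c⁻¹ * 0#                                   ≈⟨ zeroʳ c⁻¹ ⟩
        0#                                         ≈⟨ zeroˡ (t x y z) ⟨
        0# * t x y z                               ∎

  dist₁ dist₂ dist₃ : Fin N → Fin N → Fin N → ℕ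
  dist₁ x y z = dist y z
  dist₂ x y z = dist x z
  dist₃ x y z = dist x y

  dist₁≤D : ∀ x y z → dist₁ x y z ℕ.≤ D
  dist₁≤D x y z = dist≤D y z

  dist₂≤D : ∀ x y z → dist₂ x y z ℕ.≤ D
  dist₂≤D x y z = dist≤D x z

  dist₃≤D : ∀ x y z → dist₃ x y z ℕ.≤ D
  dist₃≤D x y z = dist≤D x y

  module Select₁ = Selection dist₁ dist₁≤D a*1
  module Select₂ = Selection dist₂ dist₂≤D a*2
  module Select₃ = Selection dist₃ dist₃≤D a*3

  -- Written in the shape in which indicator-InΛ obtains it from 𝟙³.
  indicator : Triple → Tensor
  indicator (h , i , j) x y z =
    𝟙 (dist y z ℕ.≟ toℕ h) * (𝟙 (dist x z ℕ.≟ toℕ i) * (𝟙 (dist x y ℕ.≟ toℕ j) * 1#))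

  indicator-InΛ : ∀ t → InΛ (indicator t)
  indicator-InΛ (h , i , j) =
    Select₁.select (toℕ h) (idx≤D h) (Select₂.select (toℕ i) (idx≤D i) (Select₃.select (toℕ j) (idx≤D j) one))

  indicator-on : ∀ t x y z → profile x y z ≡ toℕ³ t → indicator t x y z ≈ 1#
  indicator-on (h , i , j) x y z eq = begin
    𝟙 dh * (𝟙 di * (𝟙 dj * 1#))   ≈⟨ *-cong (𝟙-yes dh (≡.cong proj₁ eq)) (*-cong (𝟙-yes di (≡.cong (proj₁ ∘ proj₂) eq))
                                                                             (*-congʳ (𝟙-yes dj (≡.cong (proj₂ ∘ proj₂) eq)))) ⟩
    1# * (1# * (1# * 1#))         ≈⟨ trans (*-identityˡ _) (trans (*-identityˡ _) (*-identityˡ _)) ⟩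
    1#                            ∎
    where
    dh : Dec (dist y z ≡ toℕ h)
    dh = dist y z ℕ.≟ toℕ h
    di : Dec (dist x z ≡ toℕ i)
    di = dist x z ℕ.≟ toℕ i
    dj : Dec (dist x y ≡ toℕ j)
    dj = dist x y ℕ.≟ toℕ j

  indicator-off : ∀ t x y z → profile x y z ≢ toℕ³ t → indicator t x y z ≈ 0#
  indicator-off (h , i , j) x y z ≢t with dist y z ℕ.≟ toℕ h | dist x z ℕ.≟ toℕ i | dist x y ℕ.≟ toℕ j
  ... | yes eh | yes ei | yes ej = ⊥-elim (≢t (≡.cong₂ _,_ eh (≡.cong₂ _,_ ei ej)))
  ... | no  _  | _      | _      = zeroˡ _
  ... | yes _  | no  _  | _      = trans (*-identityˡ _) (zeroˡ _)
  ... | yes _  | yes _  | no  _  = trans (*-identityˡ _) (trans (*-identityˡ _) (zeroˡ _))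


  lincomb-at : ∀ {d} (f : Fin d → Triple) → (∀ k l → f k ≡ f l → k ≡ l) →
    ∀ a k x y z → profile x y z ≡ toℕ³ (f k) → lincomb a (indicator ∘ f) x y z ≈ a k
  lincomb-at f f-inj a k x y z eq = begin
    lincomb a (indicator ∘ f) x y z                ≡⟨ sumF≡sum (λ l → a l * indicator (f l) x y z) ⟩
    sum (λ l → a l * indicator (f l) x y z)        ≈⟨ sum-δ _ k (λ l l≢k → trans (*-congˡ (indicator-off (f l) x y z (other l l≢k))) (zeroʳ (a l))) ⟩
    a k * indicator (f k) x y z                    ≈⟨ *-congˡ (indicator-on (f k) x y z eq) ⟩
    a k * 1#                                       ≈⟨ *-identityʳ (a k) ⟩
    a k                                            ∎
    where
    other : ∀ l → l ≢ k → profile x y z ≢ toℕ³ (f l)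
    other l l≢k eq' = l≢k (f-inj l k (toℕ³-injective (f l) (f k) (≡.trans (≡.sym eq') eq)))

  -- The basis: indicators of the realised distance profiles.
  dimension : ∀ {d} → Enumerates (λ t → count t ≢ 0) d → DimΛ d
  dimension {d} (f , f-ok , f-inj , f-onto) = indicator ∘ f , indicator-InΛ ∘ f , independent , spanning
    where
    witness : Fin d → Fin N × Fin N × Fin N
    witness k = let a , b , _ = count≢0⇒decomposition (f k) (f-ok k) in a , fromℤ (val a ℤ.+ val b) , origin
    witness-profile : ∀ k → let (x , y , z) = witness k in profile x y z ≡ toℕ³ (f k)
    witness-profile k = let a , b , dec = count≢0⇒decomposition (f k) (f-ok k) in decomposition⇒profile (f k) a b dec
    at-witness : Tensor → Fin d → Carrier
    at-witness v k = let (x , y , z) = witness k in v x y z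
    independent : ∀ a → lincomb a (indicator ∘ f) ≈T (λ _ _ _ → 0#) → ∀ k → a k ≈ 0#
    independent a lincomb≈0 k = let (x , y , z) = witness k in
      trans (sym (lincomb-at f f-inj a k x y z (witness-profile k))) (lincomb≈0 x y z)
    spanning : ∀ v → InΛ v → ∃ λ a → v ≈T lincomb a (indicator ∘ f)
    spanning v v∈Λ = at-witness v , expand
      where
      expand : v ≈T lincomb (at-witness v) (indicator ∘ f)
      expand x y z = at-index (f-onto (profileᵢ x y z) (profile-count≢0 x y z))
        where
        at-index : (∃ λ k → f k ≡ profileᵢ x y z) → v x y z ≈ lincomb (at-witness v) (indicator ∘ f) x y z
        at-index (k , fk≡t) =
          trans (invariant⇒profile-determined (InΛ⇒invariant v∈Λ) (≡.trans xyz↦k (≡.sym (witness-profile k))))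
                (sym (lincomb-at f f-inj (at-witness v) k x y z xyz↦k))
          where
          xyz↦k : profile x y z ≡ toℕ³ (f k)
          xyz↦k = ≡.trans (≡.sym (toℕ³-profileᵢ x y z)) (≡.cong toℕ³ (≡.sym fk≡t))

-- Imported only here: ℕ's _*_ would clash with the ring multiplications above.
open import Data.Nat using (_*_; _≤_)

cycle-bounds : ∀ D N → 2 ≤ D → N ≡ 2 * D ⊎ N ≡ suc (2 * D) →
               D ℕ.+ D ≤ N × N ≤ suc (D ℕ.+ D) × 3 ≤ N
cycle-bounds D N 2≤D N≡ = 2D≤N , N≤2D+1 , ℕₚ.≤-trans 3≤D+D 2D≤N
  where
  2*D≡D+D : 2 * D ≡ D ℕ.+ D
  2*D≡D+D = ≡.cong (D ℕ.+_) (ℕₚ.+-identityʳ D)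
  3≤D+D : 3 ≤ D ℕ.+ D
  3≤D+D = ℕₚ.+-mono-≤ (ℕₚ.≤-trans (s≤s z≤n) 2≤D) 2≤D
  2D≤N : D ℕ.+ D ≤ N
  2D≤N = [ (λ N≡2D → ℕₚ.≤-reflexive (≡.trans (≡.sym 2*D≡D+D) (≡.sym N≡2D)))
         , (λ N≡2D+1 → ℕₚ.≤-trans (ℕₚ.n≤1+n _) (ℕₚ.≤-reflexive (≡.trans (≡.cong suc (≡.sym 2*D≡D+D)) (≡.sym N≡2D+1))))
         ]′ N≡
  N≤2D+1 : N ≤ suc (D ℕ.+ D)
  N≤2D+1 = [ (λ N≡2D → ℕₚ.≤-trans (ℕₚ.≤-reflexive (≡.trans N≡2D 2*D≡D+D)) (ℕₚ.n≤1+n _))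
           , (λ N≡2D+1 → ℕₚ.≤-reflexive (≡.trans N≡2D+1 (≡.cong suc 2*D≡D+D)))
           ]′ N≡

lemma8p1 : ∀ {c ℓ} (R : CommutativeRing c ℓ) → IsField R → CharZero R →
    (D N : ℕ) → 2 ≤ D → (N ≡ 2 * D ⊎ N ≡ suc (2 * D)) →
    (ζ : CommutativeRing.Carrier R) → IsPrimitiveRoot R N ζ →
    let open Cycle R N D ζ in
    (E : Idx → Mat) → (∀ k → IsEigenProj k (E k)) →
    (q : Idx → Idx → Idx → CommutativeRing.Carrier R) → KreinEq E q →
    ∃ λ d → NonzeroCount q d × DimΛ d
lemma8p1 R isField charZero D N 2≤D N≡ ζ ζ-primitive E E-proj q krein =
  d , nonzero-count enumeration , dimension enumeration
  where
  2D≤N : D ℕ.+ D ≤ N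
  2D≤N = proj₁ (cycle-bounds D N 2≤D N≡)
  N≤2D+1 : N ≤ suc (D ℕ.+ D)
  N≤2D+1 = proj₁ (proj₂ (cycle-bounds D N 2≤D N≡))
  3≤N : 3 ≤ N
  3≤N = proj₂ (proj₂ (cycle-bounds D N 2≤D N≡))
  instance
    N-nonZero : NonZero N
    N-nonZero = ℕ.>-nonZero (ℕₚ.≤-trans (s≤s z≤n) 3≤N)
  open CycleGraph N D 2D≤N N≤2D+1 3≤N using (count)
  open CycleSpectrum.Projections.Krein R isField N D 2D≤N N≤2D+1 3≤N ζ ζ-primitive E E-proj q krein charZero
    using (nonzero-count)
  open FundamentalModule R isField N D 2D≤N N≤2D+1 3≤N ζ ζ-primitive using (dimension)
  counted : ∃ (Enumerates (λ t → count t ≢ 0))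
  counted = enumerate-↔ (Fin³↔Fin (suc D)) (λ t → ¬? (count t ℕ.≟ 0))
  d : ℕ
  d = proj₁ counted
  enumeration : Enumerates (λ t → count t ≢ 0) d
  enumeration = proj₂ counted
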